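{- Every clause $C\in\mathcal{H}^{nr}$ is irreducible in $\mathcal{H}^{2c}_{2,\infty}$. (Since $\mathcal{H}^{nr}$ contains clauses of arbitrarily large body size, this means that for every $k$ there is an irreducible clause of $\mathcal{H}^{2c}_{2,\infty}$ of body size at least $k$.)
   Context: Clauses and fragments. - Clauses are function-free second-order Horn clauses: a head (at most one positive literal) and a finite body of negative literals. Each literal is a predicate variable applied to term variables. - The body size $|C|$ is the number of body literals. - A clause is connected if its literals cannot be partitioned into two non-empty sets with disjoint variable sets. - $\mathcal{H}^{2c}$ is the set of connected clauses in which every term variable occurs in at least two distinct literals. - $\mathcal{H}^{2c}_{2,\infty}$ restricts to literals of arity at most 2. - Clauses are considered modulo variable renaming. SLD-resolution. - Substitutions map term variables to term variables and predicate variables to predicate variables of the same arity. - An SLD-resolution inference $C_1,C_2\vdash C$ is binary resolution without factoring: a body literal of one premise is unified by a most general unifier with the head of the other, and the resolvent consists of the remaining literals with the unifier applied. Irreducibility. A clause $C\in T$ is reducible in a theory $T$ if it is the resolvent of an SLD-inference whose premises both belong to $T$ and have body size smaller than $|C|$. It is irreducible otherwise. Non-red preserving extension. If the body of a clause contains two dyadic literals sharing a variable, say $P_1(x_1,x_2),P_2(x_1,x_3)$, an extension replaces them by $P_1(x_1,x_4),P_2(x_1,x_5),P_3(x_4,x_5),P_4(x_4,x_2),P_5(x_5,x_3)$, with $P_3,P_4,P_5,x_4,x_5$ new. The set $\mathcal{H}^{nr}\subseteq\mathcal{H}^{2c}_{2,\infty}$ is the smallest set that - contains $C_{base}=P_0(x_1,x_2)\leftarrow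 P_1(x_1,x_3),P_2(x_1,x_4),P_3(x_2,x_3),P_4(x_2,x_4),P_5(x_3,x_4)$, and - is closed under non-red preserving extensions. -}

module Defs where

open import Data.Nat using (ℕ; _≤_; _<_)
open import Data.Nat.Properties using () renaming (_≟_ to _≟ℕ_)
open import Data.Bool using (Bool; true; false)
open import Data.List using (List; []; _∷_; [_]; _++_; map; length; filter; deduplicate; concatMap)
open import Data.List.Membership.Propositional using (_∈_; _∉_)
import Data.List.Properties as LP
open import Data.Maybe using (Maybe; just; nothing)
import Data.Maybe as M
open import Data.Product using (Σ; ∃; _×_; _,_)
open import Relation.Binary.PropositionalEquality using (_≡_; _≢_; refl; cong₂)
open import Relation.Nullary using (¬_; Dec; yes; no; ¬?)
open import Relation.Binary.Definitions using (DecidableEquality)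

-- A predicate variable is a pair
-- (name , arity); a literal stores the name and its argument list, the
-- arity being the length of the argument list.  So P(x,y) with name 3
-- and P(x) with name 3 involve two *different* predicate variables.

record Lit : Set where
  constructor lit
  field
    pname : ℕ
    args  : List ℕ
open Lit public

-- The body is a list read as a finite *set*
-- (duplicates and order are irrelevant; see _≈ₛ_ and bodySize).
record Clause : Set where
  constructor _⟵_
  field
    head : Maybe Lit
    body : List Lit
open Clause public

_≟L_ : DecidableEquality Lit
lit p xs ≟L lit q ys with p ≟ℕ q | LP.≡-dec _≟ℕ_ xs ys
... | yes refl | yes refl = yes refl
... | no p≢q   | _        = no λ { refl → p≢q refl }
... | yes _    | no xs≢ys = no λ { refl → xs≢ys refl }

bodySize : Clause → ℕ
bodySize C = length (deduplicate _≟L_ (body C))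

_≈ₛ_ : List Lit → List Lit → Set
xs ≈ₛ ys = ∀ L → (L ∈ xs → L ∈ ys) × (L ∈ ys → L ∈ xs)

remove : Lit → List Lit → List Lit
remove L = filter (λ M → ¬? (M ≟L L))

data SLit : Set where
  pos : Lit → SLit
  neg : Lit → SLit

svars : SLit → List ℕ
svars (pos L) = args L
svars (neg L) = args L

lits : Clause → List SLit
lits C = M.maybe (λ h → [ pos h ]) [] (head C) ++ map neg (body C)

allLits : Clause → List Lit
allLits C = M.maybe (λ h → [ h ]) [] (head C) ++ body C

tvars : Clause → List ℕ
tvars C = concatMap args (allLits C)

pvars : Clause → List (ℕ × ℕ)
pvars C = map (λ L → pname L , length (args L)) (allLits C)

pnames : Clause → List ℕ
pnames C = map pname (allLits C)

-- Substitutions: term variables to term variables, predicate variables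
-- to predicate variables of the same arity (arity is preserved by
-- construction: pv name arity is the new name, at the same arity).

record Subst : Set where
  field
    tv : ℕ → ℕ
    pv : ℕ → ℕ → ℕ
open Subst public

applyL : Subst → Lit → Lit
applyL σ (lit P xs) = lit (pv σ P (length xs)) (map (tv σ) xs)

applyC : Subst → Clause → Clause
applyC σ C = M.map (applyL σ) (head C) ⟵ map (applyL σ) (body C)

Renaming : Subst → Set
Renaming σ = (∀ x y → tv σ x ≡ tv σ y → x ≡ y)
           × (∀ n m a → pv σ n a ≡ pv σ m a → n ≡ m)

_≅_ : Clause → Clause → Set
C ≅ D = Σ Subst λ σ → Renaming σ
        × (M.map (applyL σ) (head C) ≡ head D)
        × (map (applyL σ) (body C) ≈ₛ body D)

Unifier : Subst → Lit → Lit → Set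
Unifier σ L H = applyL σ L ≡ applyL σ H

MGU : Subst → Lit → Lit → Set
MGU σ L H = Unifier σ L H
          × (∀ θ → Unifier θ L H →
               Σ Subst λ η → (∀ x → tv θ x ≡ tv η (tv σ x))
                            × (∀ n a → pv θ n a ≡ pv η (pv σ n a) a))

-- R is the resolvent of an SLD-inference C₁ , C₂ ⊢ R, where a body
-- literal L of C₁ is unified (by an mgu σ) with the head H of C₂.
-- (Both orders of the premises are covered by quantifying over C₁ , C₂.)
SLD : Clause → Clause → Clause → Set
SLD C₁ C₂ R = Σ Lit λ L → Σ Lit λ H → Σ Subst λ σ →
    L ∈ body C₁ × head C₂ ≡ just H × MGU σ L H
  × head R ≡ M.map (applyL σ) (head C₁)
  × body R ≈ₛ (map (applyL σ) (remove L (body C₁)) ++ map (applyL σ) (body C₂))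

-- premises standardised apart (clauses are taken modulo renaming)
Apart : Clause → Clause → Set
Apart C₁ C₂ = (∀ x → x ∈ tvars C₁ → x ∉ tvars C₂)
            × (∀ p → p ∈ pvars C₁ → p ∉ pvars C₂)

Connected : Clause → Set
Connected C = (S : SLit → Bool)
  → (Σ SLit λ l → l ∈ lits C × S l ≡ true)
  → (Σ SLit λ l → l ∈ lits C × S l ≡ false)
  → Σ SLit λ l₁ → Σ SLit λ l₂ → Σ ℕ λ x →
      l₁ ∈ lits C × l₂ ∈ lits C × S l₁ ≡ true × S l₂ ≡ false
      × x ∈ svars l₁ × x ∈ svars l₂

TwoOcc : Clause → Set
TwoOcc C = ∀ l → l ∈ lits C → ∀ x → x ∈ svars l →
  Σ SLit λ l' → l' ∈ lits C × l' ≢ l × x ∈ svars l'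

H2c : Clause → Set
H2c C = Connected C × TwoOcc C

H2c₂∞ : Clause → Set
H2c₂∞ C = H2c C × (∀ l → l ∈ lits C → length (svars l) ≤ 2)

Reducible : (Clause → Set) → Clause → Set
Reducible T C = Σ Clause λ C₁ → Σ Clause λ C₂ → Σ Clause λ R →
    T C₁ × T C₂ × bodySize C₁ < bodySize C × bodySize C₂ < bodySize C
  × Apart C₁ C₂ × SLD C₁ C₂ R × R ≅ C

Irreducible : (Clause → Set) → Clause → Set
Irreducible T C = T C × ¬ Reducible T C

Cbase : Clause
Cbase = just (lit 0 (1 ∷ 2 ∷ []))
  ⟵ (lit 1 (1 ∷ 3 ∷ []) ∷ lit 2 (1 ∷ 4 ∷ []) ∷ lit 3 (2 ∷ 3 ∷ [])
     ∷ lit 4 (2 ∷ 4 ∷ []) ∷ lit 5 (3 ∷ 4 ∷ []) ∷ [])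

Extension : Clause → Clause → Set
Extension C D = Σ ℕ λ p₁ → Σ ℕ λ p₂ → Σ ℕ λ p₃ → Σ ℕ λ p₄ → Σ ℕ λ p₅ →
  Σ ℕ λ x₁ → Σ ℕ λ x₂ → Σ ℕ λ x₃ → Σ ℕ λ x₄ → Σ ℕ λ x₅ →
    lit p₁ (x₁ ∷ x₂ ∷ []) ∈ body C × lit p₂ (x₁ ∷ x₃ ∷ []) ∈ body C
  × lit p₁ (x₁ ∷ x₂ ∷ []) ≢ lit p₂ (x₁ ∷ x₃ ∷ [])
  × p₃ ∉ pnames C × p₄ ∉ pnames C × p₅ ∉ pnames C
  × p₃ ≢ p₄ × p₃ ≢ p₅ × p₄ ≢ p₅
  × x₄ ∉ tvars C × x₅ ∉ tvars C × x₄ ≢ x₅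
  × head D ≡ head C
  × body D ≈ₛ (remove (lit p₁ (x₁ ∷ x₂ ∷ []))
                 (remove (lit p₂ (x₁ ∷ x₃ ∷ [])) (body C))
               ++ (lit p₁ (x₁ ∷ x₄ ∷ []) ∷ lit p₂ (x₁ ∷ x₅ ∷ [])
                   ∷ lit p₃ (x₄ ∷ x₅ ∷ []) ∷ lit p₄ (x₄ ∷ x₂ ∷ [])
                   ∷ lit p₅ (x₅ ∷ x₃ ∷ []) ∷ []))

data Hnr : Clause → Set where
  base : ∀ {C} → C ≅ Cbase → Hnr C
  ext  : ∀ {C D} → Hnr C → Extension C D → Hnr D
  ren  : ∀ {C D} → Hnr C → C ≅ D → Hnr D

-- Call x a boundary variable of a selection S of the body literals of a clause if x occurs in a
-- selected literal and also in the head or in an unselected literal.  When C is, up to renaming,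
-- the SLD-resolvent of C₁ and C₂ on the head H of C₂, select the literals of C inherited from C₂:
-- a most general unifier identifies a variable of C₂ with one of C₁ only through H, so every
-- boundary variable is the image of one of the at most two arguments of H.  Every clause of H^nr
-- is separating: a selection with at most two boundary variables selects all body literals or at
-- most one.  Hence the body of C is covered by that of C₂, or by one literal together with the
-- body of C₁ minus the resolved literal, and one premise is at least as large as C.
-- Separation (with dyadic literals, shared variables and at least three body literals) holds for
-- C_base by a finite computation and survives renaming and extension, where a selection of the
-- extended clause is pulled back to one of the original; the same properties give membership
-- in H^{2c}_{2,∞}.

module Submission where

open import Defs
open import Data.Nat using (ℕ; suc; _≤_; _<_; z≤n; s≤s; _≡ᵇ_)
open import Data.Nat.Properties using (≤-trans; ≤-refl; ≤-reflexive; <⇒≱; ≡⇒≡ᵇ) renaming (_≟_ to _≟ℕ_)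
open import Data.Bool using (Bool; true; false; if_then_else_; _xor_) renaming (_≟_ to _≟B_)
open import Data.List using (List; []; _∷_; [_]; _++_; map; length; deduplicate; replicate)
open import Data.List.Membership.Propositional using (_∈_; _∉_; find; lose)
open import Data.List.Membership.Propositional.Properties
  using (∈-map⁺; ∈-map⁻; ∈-++⁺ˡ; ∈-++⁺ʳ; ∈-++⁻; ∈-filter⁺; ∈-filter⁻; ∈-deduplicate⁺; ∈-deduplicate⁻; ∈-concatMap⁺)
open import Data.List.Membership.DecPropositional _≟ℕ_ using () renaming (_∈?_ to _∈ℕ?_)
open import Data.List.Membership.DecPropositional _≟L_ using () renaming (_∈?_ to _∈L?_)
open import Data.List.Relation.Binary.Subset.Propositional using (_⊆_)
open import Data.List.Relation.Unary.Any using (Any; here; there; any?)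
import Data.List.Relation.Unary.Any as Any
open import Data.List.Relation.Unary.All using (All)
import Data.List.Relation.Unary.All as All
open import Data.List.Relation.Unary.Unique.Propositional using (Unique)
open import Data.List.Relation.Unary.Unique.DecPropositional.Properties _≟L_ using (deduplicate-!)
open import Data.List.Relation.Unary.AllPairs using ([]; _∷_)
import Data.List.Properties as LP
open import Data.Bool.Properties using (¬-not)
open import Data.Maybe using (just; nothing)
import Data.Maybe as M
open import Data.Product using (Σ; _×_; _,_; proj₁; proj₂)
open import Data.Sum using (_⊎_; inj₁; inj₂; [_,_]′)
open import Data.Empty using (⊥; ⊥-elim)
open import Function using (_∘_; case_of_)
open import Relation.Binary.PropositionalEquality
  using (_≡_; _≢_; refl; sym; trans; cong; cong₂; subst; module ≡-Reasoning)
open import Relation.Nullary using (¬_; Dec; yes; no; ¬?; does; _×-dec_)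
open import Relation.Nullary.Decidable using (toWitness; map′; _⊎-dec_; _→-dec_; dec-true; dec-false)

card : List Lit → ℕ
card xs = length (deduplicate _≟L_ xs)

∈-remove⁺ : ∀ {L l xs} → l ∈ xs → l ≢ L → l ∈ remove L xs
∈-remove⁺ {L} = ∈-filter⁺ (λ M → ¬? (M ≟L L))

∈-remove⁻ : ∀ {L l} xs → l ∈ remove L xs → l ∈ xs × l ≢ L
∈-remove⁻ {L} xs = ∈-filter⁻ (λ M → ¬? (M ≟L L)) {xs = xs}

Unique⇒length-≤ : ∀ {xs ys : List Lit} → Unique xs → xs ⊆ ys → length xs ≤ length ys
Unique⇒length-≤ {[]} _ _ = z≤n
Unique⇒length-≤ {x ∷ xs} {ys} (x≢xs ∷ uxs) x∷xs⊆ys =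
  ≤-trans (s≤s (Unique⇒length-≤ uxs xs⊆ys∖x))
          (LP.filter-notAll (λ M → ¬? (M ≟L x)) ys (Any.map (λ x≡y y≢x → y≢x (sym x≡y)) (x∷xs⊆ys (here refl))))
  where
  xs⊆ys∖x : xs ⊆ remove x ys
  xs⊆ys∖x y∈xs = ∈-remove⁺ (x∷xs⊆ys (there y∈xs)) (λ y≡x → All.lookup x≢xs y∈xs (sym y≡x))

card-mono : ∀ {xs ys} → xs ⊆ ys → card xs ≤ card ys
card-mono {xs} xs⊆ys =
  Unique⇒length-≤ (deduplicate-! xs) (∈-deduplicate⁺ _≟L_ ∘ xs⊆ys ∘ ∈-deduplicate⁻ _≟L_ xs)

card-map : ∀ (f : Lit → Lit) xs → card (map f xs) ≤ card xs
card-map f xs = ≤-trans (card-mono {ys = map f ys} map-xs⊆map-ys)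
  (≤-trans (LP.length-deduplicate _≟L_ (map f ys)) (≤-reflexive (LP.length-map f ys)))
  where
  ys = deduplicate _≟L_ xs
  map-xs⊆map-ys : map f xs ⊆ map f ys
  map-xs⊆map-ys p with ∈-map⁻ f p
  ... | x , x∈xs , refl = ∈-map⁺ f (∈-deduplicate⁺ _≟L_ x∈xs)

card-∷ : ∀ t ys → card (t ∷ ys) ≤ suc (card ys)
card-∷ t ys = s≤s (LP.length-filter (λ y → ¬? (t ≟L y)) (deduplicate _≟L_ ys))

card-remove : ∀ {L} xs → L ∈ xs → suc (card (remove L xs)) ≤ card xs
card-remove {L} xs L∈xs = Unique⇒length-≤ (L∉ ∷ deduplicate-! (remove L xs)) L∷⊆
  where
  L∉ : All (L ≢_) (deduplicate _≟L_ (remove L xs))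
  L∉ = All.tabulate λ p L≡l → proj₂ (∈-remove⁻ xs (∈-deduplicate⁻ _≟L_ _ p)) (sym L≡l)
  L∷⊆ : L ∷ deduplicate _≟L_ (remove L xs) ⊆ deduplicate _≟L_ xs
  L∷⊆ (here refl) = ∈-deduplicate⁺ _≟L_ L∈xs
  L∷⊆ (there p) = ∈-deduplicate⁺ _≟L_ (proj₁ (∈-remove⁻ xs (∈-deduplicate⁻ _≟L_ _ p)))

no-three-distinct : ∀ {A : Set} (xs : List A) → length xs ≤ 2 → ∀ {x y z} →
  x ∈ xs → y ∈ xs → z ∈ xs → x ≢ y → x ≢ z → y ≢ z → ⊥
no-three-distinct (_ ∷ _ ∷ _ ∷ _) (s≤s (s≤s ()))
no-three-distinct (a ∷ []) _ (here refl) (here refl) _ x≢y _ _ = x≢y refl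
no-three-distinct (a ∷ b ∷ []) _ (here refl) (here refl) _ x≢y _ _ = x≢y refl
no-three-distinct (a ∷ b ∷ []) _ (there (here refl)) (there (here refl)) _ x≢y _ _ = x≢y refl
no-three-distinct (a ∷ b ∷ []) _ (here refl) _ (here refl) _ x≢z _ = x≢z refl
no-three-distinct (a ∷ b ∷ []) _ (there (here refl)) _ (there (here refl)) _ x≢z _ = x≢z refl
no-three-distinct (a ∷ b ∷ []) _ _ (here refl) (here refl) _ _ y≢z = y≢z refl
no-three-distinct (a ∷ b ∷ []) _ _ (there (here refl)) (there (here refl)) _ _ y≢z = y≢z refl

Dyadic : Lit → Set
Dyadic l = Σ ℕ λ a → Σ ℕ λ b → args l ≡ a ∷ b ∷ [] × a ≢ b

dyadic-length : ∀ l → Dyadic l → length (args l) ≤ 2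
dyadic-length l (_ , _ , args-l , _) rewrite args-l = ≤-refl

AllSelected : List Lit → (Lit → Bool) → Set
AllSelected B S = ∀ l → l ∈ B → S l ≡ true

AtMostOneSelected : List Lit → (Lit → Bool) → Set
AtMostOneSelected B S = ∀ l l' → l ∈ B → l' ∈ B → S l ≡ true → S l' ≡ true → l ≡ l'

Trivial : List Lit → (Lit → Bool) → Set
Trivial B S = AllSelected B S ⊎ AtMostOneSelected B S

module _ (h : Lit) (B : List Lit) where

  Boundary : (Lit → Bool) → ℕ → Set
  Boundary S x = (Σ Lit λ l → l ∈ B × S l ≡ true × x ∈ args l)
               × (x ∈ args h ⊎ Σ Lit λ l → l ∈ B × S l ≡ false × x ∈ args l)

  NoThreeBoundary : (Lit → Bool) → Set
  NoThreeBoundary S = ∀ x y z → Boundary S x → Boundary S y → Boundary S z →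
                      x ≢ y → x ≢ z → y ≢ z → ⊥

  Separating : Set
  Separating = ∀ S → NoThreeBoundary S → Trivial B S

  HeadVarsInBody : Set
  HeadVarsInBody = ∀ x → x ∈ args h → Σ Lit λ l → l ∈ B × x ∈ args l

  BodyVarsShared : Set
  BodyVarsShared = ∀ l → l ∈ B → ∀ x → x ∈ args l →
                   x ∈ args h ⊎ Σ Lit λ l' → l' ∈ B × l' ≢ l × x ∈ args l'

  ThreeLiterals : Set
  ThreeLiterals = Σ Lit λ l₁ → Σ Lit λ l₂ → Σ Lit λ l₃ → l₁ ∈ B × l₂ ∈ B × l₃ ∈ B
                  × l₁ ≢ l₂ × l₁ ≢ l₃ × l₂ ≢ l₃

  record NonRed : Set where
    field
      head-dyadic       : Dyadic h
      body-dyadic       : ∀ l → l ∈ B → Dyadic l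
      head-vars-in-body : HeadVarsInBody
      body-vars-shared  : BodyVarsShared
      three-literals    : ThreeLiterals
      separating        : Separating

NonRedClause : Clause → Set
NonRedClause C = Σ Lit λ h → head C ≡ just h × NonRed h (body C)

does-true : ∀ {P : Set} (d : Dec P) → does d ≡ true → P
does-true (yes p) _ = p
does-true (no _) ()

does-false : ∀ {P : Set} (d : Dec P) → does d ≡ false → ¬ P
does-false (no ¬p) _ = ¬p
does-false (yes _) ()

selected-unique : ∀ {B S} → Lit → AtMostOneSelected B S →
  Σ Lit λ t → ∀ {l} → l ∈ B → S l ≡ true → l ≡ t
selected-unique {B} {S} default amo with any? (λ l → S l ≟B true) B
... | yes some = let (t , t∈B , St) = find some in t , λ l∈B Sl → amo _ _ l∈B t∈B Sl St
... | no none  = default , λ l∈B Sl → ⊥-elim (none (lose l∈B Sl))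

∈-tvars-body : ∀ C {l x} → l ∈ body C → x ∈ args l → x ∈ tvars C
∈-tvars-body C l∈ x∈ = ∈-concatMap⁺ args (lose (∈-++⁺ʳ (M.maybe (λ h → [ h ]) [] (head C)) l∈) x∈)

∈-tvars-head : ∀ C {h x} → head C ≡ just h → x ∈ args h → x ∈ tvars C
∈-tvars-head (just h ⟵ B) refl x∈ = ∈-concatMap⁺ args {xs = h ∷ B} (lose (here refl) x∈)

pos∈lits : ∀ C {H} → head C ≡ just H → pos H ∈ lits C
pos∈lits (just H ⟵ B) refl = here refl

neg∈lits : ∀ C {L} → L ∈ body C → neg L ∈ lits C
neg∈lits C L∈ = ∈-++⁺ʳ (M.maybe (λ h → [ pos h ]) [] (head C)) (∈-map⁺ neg L∈)

collapse : List ℕ → List ℕ → ℕ → ℕ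
collapse []       hs z = z
collapse (a ∷ ls) hs z = if does (z ∈ℕ? hs ++ a ∷ ls) then a else z

collapse-unifies : ∀ ls hs → length ls ≡ length hs → map (collapse ls hs) ls ≡ map (collapse ls hs) hs
collapse-unifies []       [] _   = refl
collapse-unifies (a ∷ ls) hs len = begin
  map f (a ∷ ls)                 ≡⟨ map-to-a (a ∷ ls) (∈-++⁺ʳ hs) ⟩
  replicate (length (a ∷ ls)) a  ≡⟨ cong (λ n → replicate n a) len ⟩
  replicate (length hs) a        ≡⟨ sym (map-to-a hs ∈-++⁺ˡ) ⟩
  map f hs                       ∎
  where
  open ≡-Reasoning
  f = collapse (a ∷ ls) hs
  map-to-a : ∀ ws → (∀ {w} → w ∈ ws → w ∈ hs ++ a ∷ ls) → map f ws ≡ replicate (length ws) a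
  map-to-a []       _   = refl
  map-to-a (w ∷ ws) ws⊆ with w ∈ℕ? hs ++ a ∷ ls
  ... | yes _  = cong (a ∷_) (map-to-a ws (ws⊆ ∘ there))
  ... | no w∉ = ⊥-elim (w∉ (ws⊆ (here refl)))

collapse-fixes : ∀ ls hs {z} → z ∉ ls → z ∉ hs → collapse ls hs z ≡ z
collapse-fixes []       hs _ _ = refl
collapse-fixes (a ∷ ls) hs {z} z∉ls z∉hs with z ∈ℕ? hs ++ a ∷ ls
... | yes z∈ = ⊥-elim ([ z∉hs , z∉ls ]′ (∈-++⁻ hs z∈))
... | no _   = refl

collapse-range : ∀ ls hs z → collapse ls hs z ≡ z ⊎ collapse ls hs z ∈ ls
collapse-range []       hs z = inj₁ refl
collapse-range (a ∷ ls) hs z with z ∈ℕ? hs ++ a ∷ ls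
... | yes _ = inj₂ (here refl)
... | no _  = inj₁ refl

rename-to : ℕ → ℕ → ℕ → ℕ
rename-to p q n = if n ≡ᵇ q then p else n

rename-to-unifies : ∀ p q → rename-to p q p ≡ rename-to p q q
rename-to-unifies p q with p ≡ᵇ q | q ≡ᵇ q | ≡⇒≡ᵇ q q refl
... | true  | true  | _ = refl
... | false | true  | _ = refl
... | _     | false | ()

-- The unifier collapsing the arguments of L and H onto one argument of L fixes every other
-- variable and factors through σ, so σ identifies no variable of C₂ outside H with one of C₁.
mgu-shared-var∈head : ∀ {C₁ C₂ L H σ} → Apart C₁ C₂ → L ∈ body C₁ → MGU σ L H →
  ∀ {y w} → y ∈ tvars C₂ → w ∈ tvars C₁ → tv σ y ≡ tv σ w → y ∈ args H
mgu-shared-var∈head {C₁} {C₂} {lit pL ls} {lit pH hs} {σ} (apart , _) L∈B₁ (σ-unifies , σ-general)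
  {y} {w} y∈C₂ w∈C₁ σy≡σw with y ∈ℕ? hs
... | yes y∈hs = y∈hs
... | no  y∉hs = ⊥-elim (apart y y∈C₁ y∈C₂)
  where
  θ : Subst
  θ = record { tv = collapse ls hs ; pv = λ n _ → rename-to pL pH n }
  len : length ls ≡ length hs
  len = trans (sym (LP.length-map (tv σ) ls))
              (trans (cong (length ∘ args) σ-unifies) (LP.length-map (tv σ) hs))
  θ-unifies : Unifier θ (lit pL ls) (lit pH hs)
  θ-unifies = cong₂ lit (rename-to-unifies pL pH) (collapse-unifies ls hs len)
  η = proj₁ (σ-general θ θ-unifies)
  θ≡ησ = proj₁ (proj₂ (σ-general θ θ-unifies))
  y≡θw : y ≡ collapse ls hs w
  y≡θw = begin
    y                      ≡⟨ sym (collapse-fixes ls hs (λ y∈ls → apart y (∈-tvars-body C₁ L∈B₁ y∈ls) y∈C₂) y∉hs) ⟩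
    collapse ls hs y       ≡⟨ θ≡ησ y ⟩
    tv η (tv σ y)          ≡⟨ cong (tv η) σy≡σw ⟩
    tv η (tv σ w)          ≡⟨ sym (θ≡ησ w) ⟩
    collapse ls hs w       ∎
    where open ≡-Reasoning
  y∈C₁ : y ∈ tvars C₁
  y∈C₁ with collapse-range ls hs w
  ... | inj₁ θw≡w  = subst (_∈ tvars C₁) (sym (trans y≡θw θw≡w)) w∈C₁
  ... | inj₂ θw∈ls = ∈-tvars-body C₁ L∈B₁ (subst (_∈ ls) (sym y≡θw) θw∈ls)

module Resolvent {C C₁ C₂ R : Clause} {h L H : Lit} {σ ρ : Subst}
  (head-C : head C ≡ just h) (apart : Apart C₁ C₂) (L∈B₁ : L ∈ body C₁) (mgu : MGU σ L H)
  (head-R : head R ≡ M.map (applyL σ) (head C₁))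
  (body-R : body R ≈ₛ (map (applyL σ) (remove L (body C₁)) ++ map (applyL σ) (body C₂)))
  (ρ-injective : ∀ x y → tv ρ x ≡ tv ρ y → x ≡ y)
  (head-RC : M.map (applyL ρ) (head R) ≡ head C) (body-RC : map (applyL ρ) (body R) ≈ₛ body C)
  where

  B₁ = body C₁
  B₂ = body C₂

  τ : Lit → Lit
  τ = applyL ρ ∘ applyL σ

  g : ℕ → ℕ
  g = tv ρ ∘ tv σ

  ∈-args-τ⁻ : ∀ k {v} → v ∈ args (τ k) → Σ ℕ λ y → y ∈ args k × v ≡ g y
  ∈-args-τ⁻ k v∈ with ∈-map⁻ (tv ρ) v∈
  ... | z , z∈ , refl with ∈-map⁻ (tv σ) z∈
  ...   | y , y∈ , refl = y , y∈ , refl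

  head-C₁ : Σ Lit λ h₁ → head C₁ ≡ just h₁ × τ h₁ ≡ h
  head-C₁ with head C₁ | trans (trans (cong (M.map (applyL ρ)) (sym head-R)) head-RC) head-C
  ... | just h₁ | refl = h₁ , refl , refl

  inherited : ∀ {l} → l ∈ body C →
    (Σ Lit λ k → k ∈ remove L B₁ × l ≡ τ k) ⊎ (Σ Lit λ k → k ∈ B₂ × l ≡ τ k)
  inherited {l} l∈C with ∈-map⁻ (applyL ρ) (proj₂ (body-RC l) l∈C)
  ... | r , r∈R , refl with ∈-++⁻ (map (applyL σ) (remove L B₁)) (proj₁ (body-R r) r∈R)
  ...   | inj₁ r∈ = let (k , k∈ , r≡) = ∈-map⁻ (applyL σ) r∈ in inj₁ (k , k∈ , cong (applyL ρ) r≡)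
  ...   | inj₂ r∈ = let (k , k∈ , r≡) = ∈-map⁻ (applyL σ) r∈ in inj₂ (k , k∈ , cong (applyL ρ) r≡)

  fromC₂ : Lit → Bool
  fromC₂ l = does (l ∈L? map τ B₂)

  from-C₁-side : ∀ {v} → v ∈ args h ⊎ (Σ Lit λ l → l ∈ body C × fromC₂ l ≡ false × v ∈ args l) →
    Σ ℕ λ w → w ∈ tvars C₁ × v ≡ g w
  from-C₁-side {v} (inj₁ v∈h) with head-C₁
  ... | h₁ , head-C₁≡h₁ , refl =
    let (w , w∈ , v≡) = ∈-args-τ⁻ h₁ v∈h in w , ∈-tvars-head C₁ head-C₁≡h₁ w∈ , v≡
  from-C₁-side (inj₂ (l , l∈C , notC₂ , v∈l)) with inherited l∈C
  ... | inj₂ (k , k∈B₂ , refl) = ⊥-elim (does-false (_ ∈L? map τ B₂) notC₂ (∈-map⁺ τ k∈B₂))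
  ... | inj₁ (k , k∈ , refl) =
    let (w , w∈ , v≡) = ∈-args-τ⁻ k v∈l in w , ∈-tvars-body C₁ (proj₁ (∈-remove⁻ B₁ k∈)) w∈ , v≡

  boundary⊆head : ∀ v → Boundary h (body C) fromC₂ v → v ∈ map g (args H)
  boundary⊆head v ((l , _ , inC₂ , v∈l) , C₁-side) with ∈-map⁻ τ (does-true (_ ∈L? map τ B₂) inC₂)
  ... | k , k∈B₂ , refl with ∈-args-τ⁻ k v∈l | from-C₁-side C₁-side
  ...   | y , y∈k , refl | w , w∈C₁ , gy≡gw =
    ∈-map⁺ g (mgu-shared-var∈head {C₁} {C₂} apart L∈B₁ mgu (∈-tvars-body C₂ k∈B₂ y∈k) w∈C₁ (ρ-injective _ _ gy≡gw))

  few-boundary : length (args H) ≤ 2 → NoThreeBoundary h (body C) fromC₂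
  few-boundary |H|≤2 x y z bx by bz =
    no-three-distinct (map g (args H)) (subst (_≤ 2) (sym (LP.length-map g (args H))) |H|≤2)
      (boundary⊆head x bx) (boundary⊆head y by) (boundary⊆head z bz)

  C₂-covers : AllSelected (body C) fromC₂ → card (body C) ≤ card B₂
  C₂-covers all = ≤-trans (card-mono (λ {l} l∈ → does-true (l ∈L? map τ B₂) (all l l∈)))
                          (card-map τ B₂)

  C₁-covers : AtMostOneSelected (body C) fromC₂ → card (body C) ≤ card B₁
  C₁-covers amo = begin
    card (body C)                            ≤⟨ card-mono ⊆t∷rest ⟩
    card (t ∷ map τ (remove L B₁))           ≤⟨ card-∷ t (map τ (remove L B₁)) ⟩
    suc (card (map τ (remove L B₁)))         ≤⟨ s≤s (card-map τ (remove L B₁)) ⟩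
    suc (card (remove L B₁))                 ≤⟨ card-remove B₁ L∈B₁ ⟩
    card B₁                                  ∎
    where
    open Data.Nat.Properties.≤-Reasoning
    t = proj₁ (selected-unique L amo)
    ⊆t∷rest : body C ⊆ t ∷ map τ (remove L B₁)
    ⊆t∷rest {l} l∈C with fromC₂ l in eq | inherited l∈C
    ... | true  | _ = here (proj₂ (selected-unique L amo) l∈C eq)
    ... | false | inj₁ (k , k∈ , refl) = there (∈-map⁺ τ k∈)
    ... | false | inj₂ (k , k∈B₂ , refl) = ⊥-elim (does-false (_ ∈L? map τ B₂) eq (∈-map⁺ τ k∈B₂))

  separated : NonRed h (body C) → length (args H) ≤ 2 →
    card B₁ < card (body C) → card B₂ < card (body C) → ⊥
  separated nonRed |H|≤2 |C₁|<|C| |C₂|<|C| with NonRed.separating nonRed fromC₂ (few-boundary |H|≤2)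
  ... | inj₁ all = <⇒≱ |C₂|<|C| (C₂-covers all)
  ... | inj₂ amo = <⇒≱ |C₁|<|C| (C₁-covers amo)

nonRed⇒¬Reducible : ∀ {C} → NonRedClause C → ¬ Reducible H2c₂∞ C
nonRed⇒¬Reducible {C} (h , head-C , nonRed)
  (C₁ , C₂ , R , _ , C₂∈H , |C₁|<|C| , |C₂|<|C| , apart ,
   (L , H , σ , L∈B₁ , head-C₂ , mgu , head-R , body-R) , (ρ , (ρ-injective , _) , head-RC , body-RC)) =
  Resolvent.separated {C} {C₁} {C₂} {R} {h} {L} {H} {σ} {ρ}
    head-C apart L∈B₁ mgu head-R body-R ρ-injective head-RC body-RC
    nonRed (proj₂ C₂∈H (pos H) (pos∈lits C₂ head-C₂)) |C₁|<|C| |C₂|<|C|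

xor-true⇒≢ : ∀ {x y} → x xor y ≡ true → x ≢ y
xor-true⇒≢ {true}  {false} _ ()
xor-true⇒≢ {false} {true}  _ ()

xor-false⇒≡ : ∀ {x y} → x xor y ≡ false → x ≡ y
xor-false⇒≡ {true}  {true}  _ = refl
xor-false⇒≡ {false} {false} _ = refl

≢⇒xor-true : ∀ {x y} → x ≢ y → x xor y ≡ true
≢⇒xor-true {true}  {true}  x≢y = ⊥-elim (x≢y refl)
≢⇒xor-true {true}  {false} _   = refl
≢⇒xor-true {false} {true}  _   = refl
≢⇒xor-true {false} {false} x≢y = ⊥-elim (x≢y refl)

module NonRed⇒H2c {h : Lit} {B : List Lit} (nonRed : NonRed h B) where
  open NonRed nonRed

  C : Clause
  C = just h ⟵ B

  Crossing : (SLit → Bool) → Set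
  Crossing S = Σ SLit λ l₁ → Σ SLit λ l₂ → Σ ℕ λ x →
    l₁ ∈ lits C × l₂ ∈ lits C × S l₁ ≡ true × S l₂ ≡ false × x ∈ svars l₁ × x ∈ svars l₂

  crossing? : ∀ S → Dec (Crossing S)
  crossing? S with any? (λ l₁ → (S l₁ ≟B true) ×-dec
                     any? (λ l₂ → (S l₂ ≟B false) ×-dec any? (_∈ℕ? svars l₂) (svars l₁)) (lits C))
                   (lits C)
  ... | yes p = let (l₁ , l₁∈ , Sl₁ , q) = find p
                    (l₂ , l₂∈ , Sl₂ , r) = find q
                    (x , x∈l₁ , x∈l₂) = find r
                in yes (l₁ , l₂ , x , l₁∈ , l₂∈ , Sl₁ , Sl₂ , x∈l₁ , x∈l₂)
  ... | no ¬p = no λ (l₁ , l₂ , x , l₁∈ , l₂∈ , Sl₁ , Sl₂ , x∈l₁ , x∈l₂) →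
                  ¬p (lose l₁∈ (Sl₁ , lose l₂∈ (Sl₂ , lose x∈l₁ x∈l₂)))

  head∈ : pos h ∈ lits C
  head∈ = here refl

  body∈ : ∀ {l} → l ∈ B → neg l ∈ lits C
  body∈ = neg∈lits C

  -- Without a crossing, the body literals on the other side of S from the head form a selection
  -- without boundary variables; but it is not trivial, as a variable of the head or of its
  -- single literal would then cross.
  module NoCrossing (S : SLit → Bool) (¬crossing : ¬ Crossing S) where

    same-side : ∀ {a a' x} → a ∈ lits C → a' ∈ lits C → x ∈ svars a → x ∈ svars a' → S a ≡ S a'
    same-side {a} {a'} a∈ a'∈ x∈a x∈a' with S a in Sa | S a' in Sa'
    ... | true  | true  = refl
    ... | false | false = refl
    ... | true  | false = ⊥-elim (¬crossing (a , a' , _ , a∈ , a'∈ , Sa , Sa' , x∈a , x∈a'))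
    ... | false | true  = ⊥-elim (¬crossing (a' , a , _ , a'∈ , a∈ , Sa' , Sa , x∈a' , x∈a))

    away : Lit → Bool
    away l = S (neg l) xor S (pos h)

    no-boundary : ∀ x → ¬ Boundary h B away x
    no-boundary x ((l , l∈ , away-l , x∈l) , inj₁ x∈h) =
      xor-true⇒≢ away-l (same-side (body∈ l∈) head∈ x∈l x∈h)
    no-boundary x ((l , l∈ , away-l , x∈l) , inj₂ (l' , l'∈ , near-l' , x∈l')) =
      xor-true⇒≢ away-l (trans (same-side (body∈ l∈) (body∈ l'∈) x∈l x∈l') (xor-false⇒≡ near-l'))

    differs : ∀ {c} → c ∈ lits C → S c ≢ S (pos h) → Σ Lit λ l → l ∈ B × away l ≡ true
    differs (here refl) S≢ = ⊥-elim (S≢ refl)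
    differs (there p) S≢ with ∈-map⁻ neg p
    ... | l , l∈ , refl = l , l∈ , ≢⇒xor-true S≢

    some-away : Σ SLit (λ a → a ∈ lits C × S a ≡ true) → Σ SLit (λ a → a ∈ lits C × S a ≡ false) →
      Σ Lit λ l → l ∈ B × away l ≡ true
    some-away (a , a∈ , Sa) (a' , a'∈ , Sa') with S (pos h) ≟B true
    ... | yes Sh = differs a'∈ λ e → case trans (sym Sa') (trans e Sh) of λ ()
    ... | no ¬Sh = differs a∈ λ e → ¬Sh (trans (sym e) Sa)

    no-away-literal : Σ Lit (λ l → l ∈ B × away l ≡ true) → ⊥
    no-away-literal (l₀ , l₀∈ , away-l₀) with separating away (λ x _ _ bx _ _ _ _ _ → no-boundary x bx)
    ... | inj₁ all-away with head-dyadic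
    ...   | x , _ , args-h , _ =
      let x∈h = subst (x ∈_) (sym args-h) (here refl)
          (l , l∈ , x∈l) = head-vars-in-body x x∈h
      in xor-true⇒≢ (all-away l l∈) (same-side (body∈ l∈) head∈ x∈l x∈h)
    no-away-literal (l₀ , l₀∈ , away-l₀) | inj₂ one-away with body-dyadic l₀ l₀∈
    ... | x , _ , args-l₀ , _ with subst (x ∈_) (sym args-l₀) (here refl)
    ...   | x∈l₀ with body-vars-shared l₀ l₀∈ x x∈l₀
    ...     | inj₁ x∈h = xor-true⇒≢ away-l₀ (same-side (body∈ l₀∈) head∈ x∈l₀ x∈h)
    ...     | inj₂ (l' , l'∈ , l'≢l₀ , x∈l') =
      l'≢l₀ (one-away l' l₀ l'∈ l₀∈
               (trans (cong (_xor S (pos h)) (same-side (body∈ l'∈) (body∈ l₀∈) x∈l' x∈l₀)) away-l₀)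
               away-l₀)

  connected : Connected C
  connected S some-true some-false with crossing? S
  ... | yes crossing = crossing
  ... | no ¬crossing = ⊥-elim (no-away-literal (some-away some-true some-false))
    where open NoCrossing S ¬crossing

  two-occurrences : TwoOcc C
  two-occurrences .(pos h) (here refl) x x∈h =
    let (l , l∈ , x∈l) = head-vars-in-body x x∈h in neg l , body∈ l∈ , (λ ()) , x∈l
  two-occurrences a (there p) x x∈a with ∈-map⁻ neg p
  ... | l , l∈ , refl with body-vars-shared l l∈ x x∈a
  ...   | inj₁ x∈h = pos h , head∈ , (λ ()) , x∈h
  ...   | inj₂ (l' , l'∈ , l'≢l , x∈l') = neg l' , body∈ l'∈ , (λ { refl → l'≢l refl }) , x∈l'

  arity≤2 : ∀ a → a ∈ lits C → length (svars a) ≤ 2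
  arity≤2 .(pos h) (here refl) = dyadic-length h head-dyadic
  arity≤2 a (there p) with ∈-map⁻ neg p
  ... | l , l∈ , refl = dyadic-length l (body-dyadic l l∈)

nonRed⇒H2c₂∞ : ∀ {C} → NonRedClause C → H2c₂∞ C
nonRed⇒H2c₂∞ {just _ ⟵ B} (h , refl , nonRed) = (connected , two-occurrences) , arity≤2
  where open NonRed⇒H2c nonRed

module Renamed (σ : Subst) (injective : Renaming σ) {B B' : List Lit} (B≈ : map (applyL σ) B ≈ₛ B') where

  f : Lit → Lit
  f = applyL σ

  g : ℕ → ℕ
  g = tv σ

  g-injective : ∀ {x y} → g x ≡ g y → x ≡ y
  g-injective = proj₁ injective _ _

  f-injective : ∀ {k k'} → f k ≡ f k' → k ≡ k'
  f-injective {lit P xs} {lit Q ys} fk≡fk' = cong₂ lit P≡Q xs≡ys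
    where
    xs≡ys : xs ≡ ys
    xs≡ys = LP.map-injective g-injective (cong args fk≡fk')
    P≡Q : P ≡ Q
    P≡Q = proj₂ injective P Q (length xs) (trans (cong pname fk≡fk') (cong (pv σ Q) (cong length (sym xs≡ys))))

  ∈-args-f⁻ : ∀ k {v} → v ∈ args (f k) → Σ ℕ λ y → y ∈ args k × v ≡ g y
  ∈-args-f⁻ (lit _ xs) = ∈-map⁻ g

  ∈-args-f⁺ : ∀ k {x} → x ∈ args k → g x ∈ args (f k)
  ∈-args-f⁺ (lit _ xs) = ∈-map⁺ g

  ∈-args-f : ∀ k {x} → g x ∈ args (f k) → x ∈ args k
  ∈-args-f k gx∈ with ∈-args-f⁻ k gx∈
  ... | y , y∈k , gx≡gy = subst (_∈ args k) (sym (g-injective gx≡gy)) y∈k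

  dyadic⁺ : ∀ k → Dyadic k → Dyadic (f k)
  dyadic⁺ (lit _ _) (a , b , refl , a≢b) = g a , g b , refl , a≢b ∘ g-injective

  dyadic⁻ : ∀ k → Dyadic (f k) → Dyadic k
  dyadic⁻ (lit _ (a ∷ b ∷ [])) (_ , _ , refl , ga≢gb) = a , b , refl , ga≢gb ∘ cong g

  image : ∀ {k} → k ∈ B → f k ∈ B'
  image {k} k∈ = proj₁ (B≈ (f k)) (∈-map⁺ f k∈)

  preimage : ∀ {l} → l ∈ B' → Σ Lit λ k → k ∈ B × l ≡ f k
  preimage {l} l∈ = ∈-map⁻ f (proj₂ (B≈ l) l∈)

  trivial⁺ : ∀ {S'} → Trivial B (S' ∘ f) → Trivial B' S'
  trivial⁺ {S'} (inj₁ all) = inj₁ λ l l∈ → selected (preimage l∈)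
    where
    selected : ∀ {l} → Σ Lit (λ k → k ∈ B × l ≡ f k) → S' l ≡ true
    selected (k , k∈ , refl) = all k k∈
  trivial⁺ {S'} (inj₂ amo) = inj₂ λ l l' l∈ l'∈ Sl Sl' → same (preimage l∈) (preimage l'∈) Sl Sl'
    where
    same : ∀ {l l'} → Σ Lit (λ k → k ∈ B × l ≡ f k) → Σ Lit (λ k → k ∈ B × l' ≡ f k) →
             S' l ≡ true → S' l' ≡ true → l ≡ l'
    same (k , k∈ , refl) (k' , k'∈ , refl) Sk Sk' = cong f (amo k k' k∈ k'∈ Sk Sk')

  module _ {h : Lit} where

    boundary⁺ : ∀ {S'} x → Boundary h B (S' ∘ f) x → Boundary (f h) B' S' (g x)
    boundary⁺ x ((k , k∈ , Sk , x∈k) , inj₁ x∈h) = (f k , image k∈ , Sk , ∈-args-f⁺ k x∈k) , inj₁ (∈-args-f⁺ h x∈h)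
    boundary⁺ x ((k , k∈ , Sk , x∈k) , inj₂ (k' , k'∈ , Sk' , x∈k')) =
      (f k , image k∈ , Sk , ∈-args-f⁺ k x∈k) , inj₂ (f k' , image k'∈ , Sk' , ∈-args-f⁺ k' x∈k')

    separating⁺ : Separating h B → Separating (f h) B'
    separating⁺ sep S' noThree' = trivial⁺ (sep (S' ∘ f) noThree)
      where
      noThree : NoThreeBoundary h B (S' ∘ f)
      noThree x y z bx by bz x≢y x≢z y≢z =
        noThree' (g x) (g y) (g z) (boundary⁺ x bx) (boundary⁺ y by) (boundary⁺ z bz)
          (x≢y ∘ g-injective) (x≢z ∘ g-injective) (y≢z ∘ g-injective)

    -- f has no computable inverse, so a selection is pushed forward by searching B for a preimage.
    module PushForward (S : Lit → Bool) where

      S' : Lit → Bool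
      S' l = does (any? (λ k → (f k ≟L l) ×-dec (S k ≟B true)) B)

      S'∘f : ∀ {k} → k ∈ B → S' (f k) ≡ S k
      S'∘f {k} k∈ with any? (λ k' → (f k' ≟L f k) ×-dec (S k' ≟B true)) B | S k in Sk
      ... | yes _ | true  = refl
      ... | no ¬p | true  = ⊥-elim (¬p (lose k∈ (refl , Sk)))
      ... | no _  | false = refl
      ... | yes p | false with find p
      ...   | k' , _ , fk'≡fk , Sk' = case trans (sym Sk') (trans (cong S (f-injective fk'≡fk)) Sk) of λ ()

      boundary⁻ : ∀ v → Boundary (f h) B' S' v → Σ ℕ λ y → v ≡ g y × Boundary h B S y
      boundary⁻ v ((l , l∈ , Sl , v∈l) , other) with preimage l∈
      ... | k , k∈ , refl with ∈-args-f⁻ k v∈l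
      ...   | y , y∈k , refl = y , refl , (k , k∈ , trans (sym (S'∘f k∈)) Sl , y∈k) , other⁻ other
        where
        other⁻ : g y ∈ args (f h) ⊎ (Σ Lit λ l' → l' ∈ B' × S' l' ≡ false × g y ∈ args l') →
                 y ∈ args h ⊎ (Σ Lit λ k' → k' ∈ B × S k' ≡ false × y ∈ args k')
        other⁻ (inj₁ gy∈h) = inj₁ (∈-args-f h gy∈h)
        other⁻ (inj₂ (l' , l'∈ , Sl' , gy∈l')) with preimage l'∈
        ... | k' , k'∈ , refl = inj₂ (k' , k'∈ , trans (sym (S'∘f k'∈)) Sl' , ∈-args-f k' gy∈l')

      noThree' : NoThreeBoundary h B S → NoThreeBoundary (f h) B' S'
      noThree' noThree x y z bx by bz x≢y x≢z y≢z with boundary⁻ x bx | boundary⁻ y by | boundary⁻ z bz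
      ... | x' , refl , bx' | y' , refl , by' | z' , refl , bz' =
        noThree x' y' z' bx' by' bz' (x≢y ∘ cong g) (x≢z ∘ cong g) (y≢z ∘ cong g)

      trivial : Trivial B' S' → Trivial B S
      trivial (inj₁ all) = inj₁ λ k k∈ → trans (sym (S'∘f k∈)) (all (f k) (image k∈))
      trivial (inj₂ amo) = inj₂ λ k k' k∈ k'∈ Sk Sk' →
        f-injective (amo (f k) (f k') (image k∈) (image k'∈) (trans (S'∘f k∈) Sk) (trans (S'∘f k'∈) Sk'))

    separating⁻ : Separating (f h) B' → Separating h B
    separating⁻ sep' S noThree = trivial (sep' S' (noThree' noThree))
      where open PushForward S

    nonRed⁺ : NonRed h B → NonRed (f h) B'
    nonRed⁺ nr = record
      { head-dyadic       = dyadic⁺ h head-dyadic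
      ; body-dyadic       = λ l l∈ → body-dyadic⁺ (preimage l∈)
      ; head-vars-in-body = head-vars⁺
      ; body-vars-shared  = λ l l∈ → shared⁺ (preimage l∈)
      ; three-literals    = three⁺ three-literals
      ; separating        = separating⁺ separating
      }
      where
      open NonRed nr
      body-dyadic⁺ : ∀ {l} → Σ Lit (λ k → k ∈ B × l ≡ f k) → Dyadic l
      body-dyadic⁺ (k , k∈ , refl) = dyadic⁺ k (body-dyadic k k∈)
      head-vars⁺ : HeadVarsInBody (f h) B'
      head-vars⁺ v v∈ with ∈-args-f⁻ h v∈
      ... | y , y∈h , refl = let (k , k∈ , y∈k) = head-vars-in-body y y∈h in f k , image k∈ , ∈-args-f⁺ k y∈k
      shared⁺ : ∀ {l} → Σ Lit (λ k → k ∈ B × l ≡ f k) → ∀ x → x ∈ args l →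
                x ∈ args (f h) ⊎ Σ Lit λ l' → l' ∈ B' × l' ≢ l × x ∈ args l'
      shared⁺ (k , k∈ , refl) x x∈ with ∈-args-f⁻ k x∈
      ... | y , y∈k , refl with body-vars-shared k k∈ y y∈k
      ...   | inj₁ y∈h = inj₁ (∈-args-f⁺ h y∈h)
      ...   | inj₂ (k' , k'∈ , k'≢k , y∈k') = inj₂ (f k' , image k'∈ , k'≢k ∘ f-injective , ∈-args-f⁺ k' y∈k')
      three⁺ : ThreeLiterals h B → ThreeLiterals (f h) B'
      three⁺ (l₁ , l₂ , l₃ , l₁∈ , l₂∈ , l₃∈ , l₁≢l₂ , l₁≢l₃ , l₂≢l₃) =
        f l₁ , f l₂ , f l₃ , image l₁∈ , image l₂∈ , image l₃∈ ,
        l₁≢l₂ ∘ f-injective , l₁≢l₃ ∘ f-injective , l₂≢l₃ ∘ f-injective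

    nonRed⁻ : NonRed (f h) B' → NonRed h B
    nonRed⁻ nr = record
      { head-dyadic       = dyadic⁻ h head-dyadic
      ; body-dyadic       = λ k k∈ → dyadic⁻ k (body-dyadic (f k) (image k∈))
      ; head-vars-in-body = head-vars⁻
      ; body-vars-shared  = shared⁻
      ; three-literals    = three⁻ three-literals
      ; separating        = separating⁻ separating
      }
      where
      open NonRed nr
      head-vars⁻ : HeadVarsInBody h B
      head-vars⁻ x x∈ with head-vars-in-body (g x) (∈-args-f⁺ h x∈)
      ... | l , l∈ , gx∈l with preimage l∈
      ...   | k , k∈ , refl = k , k∈ , ∈-args-f k gx∈l
      shared⁻ : BodyVarsShared h B
      shared⁻ k k∈ x x∈ with body-vars-shared (f k) (image k∈) (g x) (∈-args-f⁺ k x∈)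
      ... | inj₁ gx∈h = inj₁ (∈-args-f h gx∈h)
      ... | inj₂ (l , l∈ , l≢fk , gx∈l) with preimage l∈
      ...   | k' , k'∈ , refl = inj₂ (k' , k'∈ , l≢fk ∘ cong f , ∈-args-f k' gx∈l)
      three⁻ : ThreeLiterals (f h) B' → ThreeLiterals h B
      three⁻ (l₁ , l₂ , l₃ , l₁∈ , l₂∈ , l₃∈ , l₁≢l₂ , l₁≢l₃ , l₂≢l₃) with preimage l₁∈ | preimage l₂∈ | preimage l₃∈
      ... | k₁ , k₁∈ , refl | k₂ , k₂∈ , refl | k₃ , k₃∈ , refl =
        k₁ , k₂ , k₃ , k₁∈ , k₂∈ , k₃∈ , l₁≢l₂ ∘ cong f , l₁≢l₃ ∘ cong f , l₂≢l₃ ∘ cong f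

nonRedClause-≅⁺ : ∀ {C D} → C ≅ D → NonRedClause C → NonRedClause D
nonRedClause-≅⁺ {just _ ⟵ B} (σ , injective , head≡ , B≈) (h , refl , nr) =
  applyL σ h , sym head≡ , Renamed.nonRed⁺ σ injective B≈ nr

nonRedClause-≅⁻ : ∀ {C D} → C ≅ D → NonRedClause D → NonRedClause C
nonRedClause-≅⁻ {just h ⟵ B} {D} (σ , injective , head≡ , B≈) (h' , head-D , nr)
  with trans head≡ head-D
... | refl = h , refl , Renamed.nonRed⁻ σ injective B≈ nr
nonRedClause-≅⁻ {nothing ⟵ _} (_ , _ , head≡ , _) (_ , head-D , _) with trans head≡ head-D
... | ()

∃∈? : (B : List Lit) (P : Lit → Set) → (∀ l → Dec (P l)) → Dec (Σ Lit λ l → l ∈ B × P l)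
∃∈? B P P? = map′ find (λ (l , l∈ , p) → lose l∈ p) (any? P? B)

∀∈? : (xs : List ℕ) (P : ℕ → Set) → (∀ x → Dec (P x)) → Dec (∀ x → x ∈ xs → P x)
∀∈? xs P P? = map′ (λ all x → All.lookup all) (λ all → All.tabulate (all _)) (All.all? P? xs)

∀-Bool? : {P : Bool → Set} → (∀ b → Dec (P b)) → Dec (∀ b → P b)
∀-Bool? P? = map′ (λ (t , f) → λ { true → t ; false → f }) (λ all → all true , all false) (P? true ×-dec P? false)

trivial? : ∀ B S → Dec (Trivial B S)
trivial? B S = all-selected? ⊎-dec at-most-one?
  where
  all-selected? = map′ (λ all l → All.lookup all) (λ all → All.tabulate (all _))
                       (All.all? (λ l → S l ≟B true) B)
  at-most-one? = map′ (λ amo l l' l∈ l'∈ → All.lookup (All.lookup amo l∈) l'∈)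
                      (λ amo → All.tabulate λ l∈ → All.tabulate (amo _ _ l∈))
                      (All.all? (λ l → All.all? (λ l' →
                        (S l ≟B true) →-dec (S l' ≟B true) →-dec (l ≟L l')) B) B)

trivial-agree : ∀ {B S S'} → (∀ {l} → l ∈ B → S l ≡ S' l) → Trivial B S → Trivial B S'
trivial-agree S≡S' (inj₁ all) = inj₁ λ l l∈ → trans (sym (S≡S' l∈)) (all l l∈)
trivial-agree S≡S' (inj₂ amo) = inj₂ λ l l' l∈ l'∈ Sl Sl' →
  amo l l' l∈ l'∈ (trans (S≡S' l∈) Sl) (trans (S≡S' l'∈) Sl')

module _ (h : Lit) (B : List Lit) where

  head-vars-in-body? : Dec (HeadVarsInBody h B)
  head-vars-in-body? = ∀∈? (args h) _ λ x → ∃∈? B _ λ l → x ∈ℕ? args l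

  body-vars-shared? : Dec (BodyVarsShared h B)
  body-vars-shared? = map′ (λ all l l∈ → All.lookup all l∈) (λ all → All.tabulate (all _))
    (All.all? (λ l → ∀∈? (args l) _ λ x →
       (x ∈ℕ? args h) ⊎-dec ∃∈? B _ λ l' → ¬? (l' ≟L l) ×-dec (x ∈ℕ? args l')) B)

  boundary? : ∀ S x → Dec (Boundary h B S x)
  boundary? S x = ∃∈? B _ (λ l → (S l ≟B true) ×-dec (x ∈ℕ? args l))
           ×-dec ((x ∈ℕ? args h) ⊎-dec ∃∈? B _ (λ l → (S l ≟B false) ×-dec (x ∈ℕ? args l)))

  ThreeBoundaryAmong : List ℕ → (Lit → Bool) → Set
  ThreeBoundaryAmong xs S = Any (λ x → Any (λ y → Any (λ z →
    (x ≢ y × x ≢ z × y ≢ z) × Boundary h B S x × Boundary h B S y × Boundary h B S z) xs) xs) xs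

  threeBoundaryAmong? : ∀ xs S → Dec (ThreeBoundaryAmong xs S)
  threeBoundaryAmong? xs S = any? (λ x → any? (λ y → any? (λ z →
    (¬? (x ≟ℕ y) ×-dec ¬? (x ≟ℕ z) ×-dec ¬? (y ≟ℕ z)) ×-dec boundary? S x ×-dec boundary? S y ×-dec boundary? S z)
      xs) xs) xs

module _ {h : Lit} {B : List Lit} where

  boundary-agree : ∀ {S S'} → (∀ {l} → l ∈ B → S l ≡ S' l) → ∀ {x} → Boundary h B S x → Boundary h B S' x
  boundary-agree S≡S' ((l , l∈ , Sl , x∈l) , inj₁ x∈h) = (l , l∈ , trans (sym (S≡S' l∈)) Sl , x∈l) , inj₁ x∈h
  boundary-agree S≡S' ((l , l∈ , Sl , x∈l) , inj₂ (l' , l'∈ , Sl' , x∈l')) =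
    (l , l∈ , trans (sym (S≡S' l∈)) Sl , x∈l) , inj₂ (l' , l'∈ , trans (sym (S≡S' l'∈)) Sl' , x∈l')

  ¬noThreeBoundary : ∀ {xs S} → ThreeBoundaryAmong h B xs S → ¬ NoThreeBoundary h B S
  ¬noThreeBoundary three noThree with find three
  ... | x , _ , three-y with find three-y
  ...   | y , _ , three-z with find three-z
  ...     | z , _ , (x≢y , x≢z , y≢z) , bx , by , bz = noThree x y z bx by bz x≢y x≢z y≢z

base-head : Lit
base-head = lit 0 (1 ∷ 2 ∷ [])

base-body : List Lit
base-body = body Cbase

base-selection : (b₁ b₂ b₃ b₄ b₅ : Bool) → Lit → Bool
base-selection b₁ _  _  _  _  (lit 1 _) = b₁
base-selection _  b₂ _  _  _  (lit 2 _) = b₂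
base-selection _  _  b₃ _  _  (lit 3 _) = b₃
base-selection _  _  _  b₄ _  (lit 4 _) = b₄
base-selection _  _  _  _  b₅ (lit 5 _) = b₅
base-selection _  _  _  _  _  _         = false

base-check : ∀ b₁ b₂ b₃ b₄ b₅ → let S = base-selection b₁ b₂ b₃ b₄ b₅ in
  Trivial base-body S ⊎ ThreeBoundaryAmong base-head base-body (1 ∷ 2 ∷ 3 ∷ 4 ∷ []) S
base-check = toWitness {a? = ∀-Bool? λ b₁ → ∀-Bool? λ b₂ → ∀-Bool? λ b₃ → ∀-Bool? λ b₄ → ∀-Bool? λ b₅ →
  let S = base-selection b₁ b₂ b₃ b₄ b₅ in
  trivial? base-body S ⊎-dec threeBoundaryAmong? base-head base-body (1 ∷ 2 ∷ 3 ∷ 4 ∷ []) S} _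

base-separating : Separating base-head base-body
base-separating S noThree = [ trivial-agree agree , ⊥-elim ∘ three-contradicts ]′ (base-check b₁ b₂ b₃ b₄ b₅)
  where
  b₁ = S (lit 1 (1 ∷ 3 ∷ []))
  b₂ = S (lit 2 (1 ∷ 4 ∷ []))
  b₃ = S (lit 3 (2 ∷ 3 ∷ []))
  b₄ = S (lit 4 (2 ∷ 4 ∷ []))
  b₅ = S (lit 5 (3 ∷ 4 ∷ []))
  S♭ = base-selection b₁ b₂ b₃ b₄ b₅
  agree : ∀ {l} → l ∈ base-body → S♭ l ≡ S l
  agree (here refl) = refl
  agree (there (here refl)) = refl
  agree (there (there (here refl))) = refl
  agree (there (there (there (here refl)))) = refl
  agree (there (there (there (there (here refl))))) = refl
  three-contradicts : ThreeBoundaryAmong base-head base-body (1 ∷ 2 ∷ 3 ∷ 4 ∷ []) S♭ → ⊥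
  three-contradicts three = ¬noThreeBoundary {base-head} three λ x y z bx by bz →
    noThree x y z (agree-on bx) (agree-on by) (agree-on bz)
    where
    agree-on : ∀ {x} → Boundary base-head base-body S♭ x → Boundary base-head base-body S x
    agree-on = boundary-agree {base-head} agree

base-nonRed : NonRed base-head base-body
base-nonRed = record
  { head-dyadic       = 1 , 2 , refl , λ ()
  ; body-dyadic       = λ { _ (here refl) → 1 , 3 , refl , λ ()
                          ; _ (there (here refl)) → 1 , 4 , refl , λ ()
                          ; _ (there (there (here refl))) → 2 , 3 , refl , λ ()
                          ; _ (there (there (there (here refl)))) → 2 , 4 , refl , λ ()
                          ; _ (there (there (there (there (here refl))))) → 3 , 4 , refl , λ () }
  ; head-vars-in-body = toWitness {a? = head-vars-in-body? base-head base-body} _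
  ; body-vars-shared  = toWitness {a? = body-vars-shared? base-head base-body} _
  ; three-literals    = _ , _ , _ , here refl , there (here refl) , there (there (here refl)) ,
                        (λ ()) , (λ ()) , (λ ())
  ; separating        = base-separating
  }

in-pair : ∀ {v a b : ℕ} → v ∈ a ∷ b ∷ [] → v ≡ a ⊎ v ≡ b
in-pair (here v≡a)         = inj₁ v≡a
in-pair (there (here v≡b)) = inj₂ v≡b

module SharedPair {h : Lit} {B : List Lit} (nonRed : NonRed h B) {p₁ p₂ x₁ x₂ x₃ : ℕ}
  (e₁∈B : lit p₁ (x₁ ∷ x₂ ∷ []) ∈ B) (e₂∈B : lit p₂ (x₁ ∷ x₃ ∷ []) ∈ B)
  (e₁≢e₂ : lit p₁ (x₁ ∷ x₂ ∷ []) ≢ lit p₂ (x₁ ∷ x₃ ∷ []))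
  where
  open NonRed nonRed

  e₁ e₂ : Lit
  e₁ = lit p₁ (x₁ ∷ x₂ ∷ [])
  e₂ = lit p₂ (x₁ ∷ x₃ ∷ [])

  x₁≢x₂ : x₁ ≢ x₂
  x₁≢x₂ with body-dyadic e₁ e₁∈B
  ... | _ , _ , refl , x₁≢x₂ = x₁≢x₂

  x₁≢x₃ : x₁ ≢ x₃
  x₁≢x₃ with body-dyadic e₂ e₂∈B
  ... | _ , _ , refl , x₁≢x₃ = x₁≢x₃

  Outside : ℕ → Set
  Outside v = v ∈ args h ⊎ Σ Lit λ o → o ∈ B × o ≢ e₁ × o ≢ e₂ × v ∈ args o

  pair : Lit → Bool
  pair l = does (l ∈L? e₁ ∷ e₂ ∷ [])

  pair-nontrivial : ¬ Trivial B pair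
  pair-nontrivial (inj₂ amo) = e₁≢e₂ (amo e₁ e₂ e₁∈B e₂∈B
    (dec-true (e₁ ∈L? e₁ ∷ e₂ ∷ []) (here refl)) (dec-true (e₂ ∈L? e₁ ∷ e₂ ∷ []) (there (here refl))))
  pair-nontrivial (inj₁ all) with three-literals
  ... | l₁ , l₂ , l₃ , l₁∈ , l₂∈ , l₃∈ , l₁≢l₂ , l₁≢l₃ , l₂≢l₃ =
    no-three-distinct (e₁ ∷ e₂ ∷ []) ≤-refl (in-pair′ l₁∈) (in-pair′ l₂∈) (in-pair′ l₃∈) l₁≢l₂ l₁≢l₃ l₂≢l₃
    where
    in-pair′ : ∀ {l} → l ∈ B → l ∈ e₁ ∷ e₂ ∷ []
    in-pair′ {l} l∈ = does-true (l ∈L? e₁ ∷ e₂ ∷ []) (all l l∈)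

  pair-boundary-vars : ∀ {v} → Boundary h B pair v → v ≡ x₁ ⊎ v ≡ x₂ ⊎ v ≡ x₃
  pair-boundary-vars ((l , _ , selected , v∈l) , _) with does-true (l ∈L? e₁ ∷ e₂ ∷ []) selected
  ... | here refl with in-pair v∈l
  ...   | inj₁ v≡x₁ = inj₁ v≡x₁
  ...   | inj₂ v≡x₂ = inj₂ (inj₁ v≡x₂)
  pair-boundary-vars ((l , _ , selected , v∈l) , _) | there (here refl) with in-pair v∈l
  ...   | inj₁ v≡x₁ = inj₁ v≡x₁
  ...   | inj₂ v≡x₃ = inj₂ (inj₂ v≡x₃)

  pair-boundary-outside : ∀ {v} → Boundary h B pair v → Outside v
  pair-boundary-outside (_ , inj₁ v∈h) = inj₁ v∈h
  pair-boundary-outside (_ , inj₂ (o , o∈ , unselected , v∈o)) =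
    inj₂ (o , o∈ , (λ o≡e₁ → does-false (o ∈L? e₁ ∷ e₂ ∷ []) unselected (here o≡e₁)) ,
                   (λ o≡e₂ → does-false (o ∈L? e₁ ∷ e₂ ∷ []) unselected (there (here o≡e₂))) , v∈o)

  -- Both x₂ ≡ x₃ and x₁ occurring only in e₁ and e₂ would leave `pair` two boundary variables.
  boundary-among-two : ∀ {a b} → (∀ {v} → Boundary h B pair v → v ∈ a ∷ b ∷ []) → ⊥
  boundary-among-two among = pair-nontrivial (separating pair λ x y z bx by bz →
    no-three-distinct (_ ∷ _ ∷ []) ≤-refl (among bx) (among by) (among bz))

  x₂≢x₃ : x₂ ≢ x₃
  x₂≢x₃ refl = boundary-among-two λ b → case pair-boundary-vars b of λ
    { (inj₁ v≡x₁) → here v≡x₁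
    ; (inj₂ (inj₁ v≡x₂)) → there (here v≡x₂)
    ; (inj₂ (inj₂ v≡x₃)) → there (here v≡x₃) }

  outside? : ∀ v → Dec (Outside v)
  outside? v = (v ∈ℕ? args h) ⊎-dec ∃∈? B _ (λ o → ¬? (o ≟L e₁) ×-dec ¬? (o ≟L e₂) ×-dec (v ∈ℕ? args o))

  x₁-outside : Outside x₁
  x₁-outside with outside? x₁
  ... | yes outside = outside
  ... | no ¬outside = ⊥-elim (boundary-among-two λ b → case pair-boundary-vars b of λ
    { (inj₁ refl) → ⊥-elim (¬outside (pair-boundary-outside b))
    ; (inj₂ (inj₁ v≡x₂)) → here v≡x₂
    ; (inj₂ (inj₂ v≡x₃)) → there (here v≡x₃) })

  x₂-outside : Outside x₂
  x₂-outside with body-vars-shared e₁ e₁∈B x₂ (there (here refl))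
  ... | inj₁ x₂∈h = inj₁ x₂∈h
  ... | inj₂ (o , o∈ , o≢e₁ , x₂∈o) = inj₂ (o , o∈ , o≢e₁ , o≢e₂ , x₂∈o)
    where
    o≢e₂ : o ≢ e₂
    o≢e₂ refl = [ x₁≢x₂ ∘ sym , x₂≢x₃ ]′ (in-pair x₂∈o)

  x₃-outside : Outside x₃
  x₃-outside with body-vars-shared e₂ e₂∈B x₃ (there (here refl))
  ... | inj₁ x₃∈h = inj₁ x₃∈h
  ... | inj₂ (o , o∈ , o≢e₂ , x₃∈o) = inj₂ (o , o∈ , o≢e₁ , o≢e₂ , x₃∈o)
    where
    o≢e₁ : o ≢ e₁
    o≢e₁ refl = [ x₁≢x₃ ∘ sym , x₂≢x₃ ∘ sym ]′ (in-pair x₃∈o)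

≢-by-1st : ∀ {p q a a' b b'} → a ≢ a' → lit p (a ∷ b ∷ []) ≢ lit q (a' ∷ b' ∷ [])
≢-by-1st a≢a' refl = a≢a' refl

≢-by-2nd : ∀ {p q a a' b b'} → b ≢ b' → lit p (a ∷ b ∷ []) ≢ lit q (a' ∷ b' ∷ [])
≢-by-2nd b≢b' refl = b≢b' refl

∈₁ : ∀ {a b : ℕ} → a ∈ a ∷ b ∷ []
∈₁ = here refl

∈₂ : ∀ {a b : ℕ} → b ∈ a ∷ b ∷ []
∈₂ = there (here refl)

≢-sym : ∀ {A : Set} {a b : A} → a ≢ b → b ≢ a
≢-sym a≢b = a≢b ∘ sym

dyadic-other : ∀ l → Dyadic l → ∀ v → Σ ℕ λ w → w ∈ args l × w ≢ v
dyadic-other l (a , b , args-l , a≢b) v with a ≟ℕ v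
... | yes refl = b , subst (b ∈_) (sym args-l) ∈₂ , ≢-sym a≢b
... | no a≢v   = a , subst (a ∈_) (sym args-l) ∈₁ , a≢v

module Extend {h : Lit} {B B' : List Lit} (nonRed : NonRed h B) {p₁ p₂ p₃ p₄ p₅ x₁ x₂ x₃ x₄ x₅ : ℕ}
  (e₁∈B : lit p₁ (x₁ ∷ x₂ ∷ []) ∈ B) (e₂∈B : lit p₂ (x₁ ∷ x₃ ∷ []) ∈ B)
  (e₁≢e₂ : lit p₁ (x₁ ∷ x₂ ∷ []) ≢ lit p₂ (x₁ ∷ x₃ ∷ []))
  (x₄-fresh : x₄ ∉ tvars (just h ⟵ B)) (x₅-fresh : x₅ ∉ tvars (just h ⟵ B)) (x₄≢x₅ : x₄ ≢ x₅)
  (B'≈ : B' ≈ₛ (remove (lit p₁ (x₁ ∷ x₂ ∷ [])) (remove (lit p₂ (x₁ ∷ x₃ ∷ [])) B)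
                ++ (lit p₁ (x₁ ∷ x₄ ∷ []) ∷ lit p₂ (x₁ ∷ x₅ ∷ []) ∷ lit p₃ (x₄ ∷ x₅ ∷ [])
                    ∷ lit p₄ (x₄ ∷ x₂ ∷ []) ∷ lit p₅ (x₅ ∷ x₃ ∷ []) ∷ [])))
  where
  open NonRed nonRed
  open SharedPair nonRed e₁∈B e₂∈B e₁≢e₂

  f₁ f₂ f₃ f₄ f₅ : Lit
  f₁ = lit p₁ (x₁ ∷ x₄ ∷ [])
  f₂ = lit p₂ (x₁ ∷ x₅ ∷ [])
  f₃ = lit p₃ (x₄ ∷ x₅ ∷ [])
  f₄ = lit p₄ (x₄ ∷ x₂ ∷ [])
  f₅ = lit p₅ (x₅ ∷ x₃ ∷ [])

  data Member (l : Lit) : Set where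
    old   : l ∈ B → l ≢ e₁ → l ≢ e₂ → Member l
    is-f₁ : l ≡ f₁ → Member l
    is-f₂ : l ≡ f₂ → Member l
    is-f₃ : l ≡ f₃ → Member l
    is-f₄ : l ≡ f₄ → Member l
    is-f₅ : l ≡ f₅ → Member l

  member : ∀ {l} → l ∈ B' → Member l
  member {l} l∈ with ∈-++⁻ (remove e₁ (remove e₂ B)) (proj₁ (B'≈ l) l∈)
  ... | inj₁ l∈old = let (l∈B∖e₂ , l≢e₁) = ∈-remove⁻ (remove e₂ B) l∈old
                         (l∈B , l≢e₂) = ∈-remove⁻ B l∈B∖e₂
                     in old l∈B l≢e₁ l≢e₂
  ... | inj₂ (here l≡f₁) = is-f₁ l≡f₁
  ... | inj₂ (there (here l≡f₂)) = is-f₂ l≡f₂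
  ... | inj₂ (there (there (here l≡f₃))) = is-f₃ l≡f₃
  ... | inj₂ (there (there (there (here l≡f₄)))) = is-f₄ l≡f₄
  ... | inj₂ (there (there (there (there (here l≡f₅))))) = is-f₅ l≡f₅

  old∈B' : ∀ {l} → l ∈ B → l ≢ e₁ → l ≢ e₂ → l ∈ B'
  old∈B' {l} l∈ l≢e₁ l≢e₂ = proj₂ (B'≈ l) (∈-++⁺ˡ (∈-remove⁺ (∈-remove⁺ l∈ l≢e₂) l≢e₁))

  new∈B' : ∀ {l} → l ∈ f₁ ∷ f₂ ∷ f₃ ∷ f₄ ∷ f₅ ∷ [] → l ∈ B'
  new∈B' {l} l∈ = proj₂ (B'≈ l) (∈-++⁺ʳ (remove e₁ (remove e₂ B)) l∈)

  f₁∈B' : f₁ ∈ B'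
  f₁∈B' = new∈B' (here refl)
  f₂∈B' : f₂ ∈ B'
  f₂∈B' = new∈B' (there (here refl))
  f₃∈B' : f₃ ∈ B'
  f₃∈B' = new∈B' (there (there (here refl)))
  f₄∈B' : f₄ ∈ B'
  f₄∈B' = new∈B' (there (there (there (here refl))))
  f₅∈B' : f₅ ∈ B'
  f₅∈B' = new∈B' (there (there (there (there (here refl)))))

  x₄∉old : ∀ {l v} → l ∈ B → v ∈ args l → v ≢ x₄
  x₄∉old l∈ v∈ refl = x₄-fresh (∈-tvars-body (just h ⟵ B) l∈ v∈)

  x₅∉old : ∀ {l v} → l ∈ B → v ∈ args l → v ≢ x₅
  x₅∉old l∈ v∈ refl = x₅-fresh (∈-tvars-body (just h ⟵ B) l∈ v∈)

  x₄∉head : ∀ {v} → v ∈ args h → v ≢ x₄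
  x₄∉head v∈ refl = x₄-fresh (∈-tvars-head (just h ⟵ B) refl v∈)

  x₅∉head : ∀ {v} → v ∈ args h → v ≢ x₅
  x₅∉head v∈ refl = x₅-fresh (∈-tvars-head (just h ⟵ B) refl v∈)

  x₁≢x₄ : x₁ ≢ x₄
  x₁≢x₄ = x₄∉old e₁∈B ∈₁
  x₁≢x₅ : x₁ ≢ x₅
  x₁≢x₅ = x₅∉old e₁∈B ∈₁
  x₂≢x₄ : x₂ ≢ x₄
  x₂≢x₄ = x₄∉old e₁∈B ∈₂
  x₂≢x₅ : x₂ ≢ x₅
  x₂≢x₅ = x₅∉old e₁∈B ∈₂
  x₃≢x₄ : x₃ ≢ x₄
  x₃≢x₄ = x₄∉old e₂∈B ∈₂
  x₃≢x₅ : x₃ ≢ x₅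
  x₃≢x₅ = x₅∉old e₂∈B ∈₂

  old≢new : ∀ {l f} → l ∈ B → x₄ ∈ args f ⊎ x₅ ∈ args f → l ≢ f
  old≢new l∈ (inj₁ x₄∈f) refl = x₄∉old l∈ x₄∈f refl
  old≢new l∈ (inj₂ x₅∈f) refl = x₅∉old l∈ x₅∈f refl

  body-dyadic′ : ∀ l → l ∈ B' → Dyadic l
  body-dyadic′ l l∈ with member l∈
  ... | old l∈B _ _ = body-dyadic l l∈B
  ... | is-f₁ refl  = x₁ , x₄ , refl , x₁≢x₄
  ... | is-f₂ refl  = x₁ , x₅ , refl , x₁≢x₅
  ... | is-f₃ refl  = x₄ , x₅ , refl , x₄≢x₅
  ... | is-f₄ refl  = x₄ , x₂ , refl , ≢-sym x₂≢x₄
  ... | is-f₅ refl  = x₅ , x₃ , refl , ≢-sym x₃≢x₅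

  survives : ∀ {l v} → l ∈ B → v ∈ args l →
    Σ Lit λ l' → l' ∈ B' × v ∈ args l' × (l' ≡ l ⊎ (∀ {k} → k ∈ B → k ≢ l'))
  survives {l} l∈ v∈ with l ≟L e₁ | l ≟L e₂
  ... | yes refl | _ with in-pair v∈
  ...   | inj₁ refl = f₁ , f₁∈B' , ∈₁ , inj₂ λ k∈ → old≢new k∈ (inj₁ ∈₂)
  ...   | inj₂ refl = f₄ , f₄∈B' , ∈₂ , inj₂ λ k∈ → old≢new k∈ (inj₁ ∈₁)
  survives {l} l∈ v∈ | no _ | yes refl with in-pair v∈
  ...   | inj₁ refl = f₂ , f₂∈B' , ∈₁ , inj₂ λ k∈ → old≢new k∈ (inj₂ ∈₂)
  ...   | inj₂ refl = f₅ , f₅∈B' , ∈₂ , inj₂ λ k∈ → old≢new k∈ (inj₂ ∈₁)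
  survives {l} l∈ v∈ | no l≢e₁ | no l≢e₂ = l , old∈B' l∈ l≢e₁ l≢e₂ , v∈ , inj₁ refl

  head-vars-in-body′ : HeadVarsInBody h B'
  head-vars-in-body′ x x∈h =
    let (l , l∈ , x∈l) = head-vars-in-body x x∈h
        (l' , l'∈ , x∈l' , _) = survives l∈ x∈l
    in l' , l'∈ , x∈l'

  via-outside : ∀ {v f} → Outside v → (∀ {o} → o ∈ B → o ≢ f) →
    v ∈ args h ⊎ Σ Lit λ l' → l' ∈ B' × l' ≢ f × v ∈ args l'
  via-outside (inj₁ v∈h) _ = inj₁ v∈h
  via-outside (inj₂ (o , o∈ , o≢e₁ , o≢e₂ , v∈o)) o≢f = inj₂ (o , old∈B' o∈ o≢e₁ o≢e₂ , o≢f o∈ , v∈o)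

  body-vars-shared′ : BodyVarsShared h B'
  body-vars-shared′ l l∈ x x∈ with member l∈
  ... | old l∈B _ _ with body-vars-shared l l∈B x x∈
  ...   | inj₁ x∈h = inj₁ x∈h
  ...   | inj₂ (k , k∈ , k≢l , x∈k) with survives k∈ x∈k
  ...     | l' , l'∈ , x∈l' , inj₁ refl = inj₂ (l' , l'∈ , k≢l , x∈l')
  ...     | l' , l'∈ , x∈l' , inj₂ new  = inj₂ (l' , l'∈ , ≢-sym (new l∈B) , x∈l')
  body-vars-shared′ l l∈ x x∈ | is-f₁ refl with in-pair x∈
  ... | inj₁ refl = inj₂ (f₂ , f₂∈B' , ≢-by-2nd (≢-sym x₄≢x₅) , ∈₁)
  ... | inj₂ refl = inj₂ (f₃ , f₃∈B' , ≢-by-1st (≢-sym x₁≢x₄) , ∈₁)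
  body-vars-shared′ l l∈ x x∈ | is-f₂ refl with in-pair x∈
  ... | inj₁ refl = inj₂ (f₁ , f₁∈B' , ≢-by-2nd x₄≢x₅ , ∈₁)
  ... | inj₂ refl = inj₂ (f₃ , f₃∈B' , ≢-by-1st (≢-sym x₁≢x₄) , ∈₂)
  body-vars-shared′ l l∈ x x∈ | is-f₃ refl with in-pair x∈
  ... | inj₁ refl = inj₂ (f₁ , f₁∈B' , ≢-by-1st x₁≢x₄ , ∈₂)
  ... | inj₂ refl = inj₂ (f₂ , f₂∈B' , ≢-by-1st x₁≢x₄ , ∈₂)
  body-vars-shared′ l l∈ x x∈ | is-f₄ refl with in-pair x∈
  ... | inj₁ refl = inj₂ (f₁ , f₁∈B' , ≢-by-1st x₁≢x₄ , ∈₂)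
  ... | inj₂ refl = via-outside x₂-outside λ o∈ → old≢new o∈ (inj₁ ∈₁)
  body-vars-shared′ l l∈ x x∈ | is-f₅ refl with in-pair x∈
  ... | inj₁ refl = inj₂ (f₂ , f₂∈B' , ≢-by-1st x₁≢x₅ , ∈₂)
  ... | inj₂ refl = via-outside x₃-outside λ o∈ → old≢new o∈ (inj₂ ∈₁)

  three-literals′ : ThreeLiterals h B'
  three-literals′ = f₁ , f₂ , f₃ , f₁∈B' , f₂∈B' , f₃∈B' , ≢-by-2nd x₄≢x₅ , ≢-by-1st x₁≢x₄ , ≢-by-1st x₁≢x₄

  -- A selection S' of B' pulls back to S on B, giving e₁ and e₂ the colours of f₄ and f₅ (the new
  -- literals carrying their second variables); its boundary variables map injectively to those of
  -- S', x₁ going to one of x₁, x₄, x₅.  So S is trivial, and in each case the colours of f₁, f₂, f₃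
  -- are forced: any other choice exhibits three boundary variables of S'.
  module Pullback (S' : Lit → Bool) (noThree' : NoThreeBoundary h B' S') where

    S : Lit → Bool
    S l = if does (l ≟L e₁) then S' f₄ else if does (l ≟L e₂) then S' f₅ else S' l

    S-e₁ : S e₁ ≡ S' f₄
    S-e₁ rewrite dec-true (e₁ ≟L e₁) refl = refl

    S-e₂ : S e₂ ≡ S' f₅
    S-e₂ rewrite dec-false (e₂ ≟L e₁) (≢-sym e₁≢e₂) | dec-true (e₂ ≟L e₂) refl = refl

    S-old : ∀ {l} → l ≢ e₁ → l ≢ e₂ → S l ≡ S' l
    S-old {l} l≢e₁ l≢e₂ rewrite dec-false (l ≟L e₁) l≢e₁ | dec-false (l ≟L e₂) l≢e₂ = refl

    classify : ∀ l → l ≡ e₁ ⊎ (l ≢ e₁ × l ≡ e₂) ⊎ (l ≢ e₁ × l ≢ e₂)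
    classify l with l ≟L e₁ | l ≟L e₂
    ... | yes l≡e₁ | _        = inj₁ l≡e₁
    ... | no l≢e₁  | yes l≡e₂ = inj₂ (inj₁ (l≢e₁ , l≡e₂))
    ... | no l≢e₁  | no l≢e₂  = inj₂ (inj₂ (l≢e₁ , l≢e₂))

    clash : ∀ {A : Set} {l} → S' l ≡ true → S' l ≡ false → A
    clash Sl≡t Sl≡f = case trans (sym Sl≡t) Sl≡f of λ ()

    boundary′ : ∀ {v l l'} → l ∈ B' → S' l ≡ true → v ∈ args l → l' ∈ B' → S' l' ≡ false → v ∈ args l' →
      Boundary h B' S' v
    boundary′ l∈ Sl v∈l l'∈ Sl' v∈l' = (_ , l∈ , Sl , v∈l) , inj₂ (_ , l'∈ , Sl' , v∈l')

    head-boundary′ : ∀ {v l} → l ∈ B' → S' l ≡ true → v ∈ args l → v ∈ args h → Boundary h B' S' v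
    head-boundary′ l∈ Sl v∈l v∈h = (_ , l∈ , Sl , v∈l) , inj₁ v∈h

    counterpart : ∀ {l v} → l ∈ B → v ∈ args l → v ≢ x₁ → Σ Lit λ l' → l' ∈ B' × S' l' ≡ S l × v ∈ args l'
    counterpart {l} l∈ v∈ v≢x₁ with classify l
    ... | inj₁ refl with in-pair v∈
    ...   | inj₁ v≡x₁ = ⊥-elim (v≢x₁ v≡x₁)
    ...   | inj₂ refl = f₄ , f₄∈B' , sym S-e₁ , ∈₂
    counterpart {l} l∈ v∈ v≢x₁ | inj₂ (inj₁ (_ , refl)) with in-pair v∈
    ...   | inj₁ v≡x₁ = ⊥-elim (v≢x₁ v≡x₁)
    ...   | inj₂ refl = f₅ , f₅∈B' , sym S-e₂ , ∈₂
    counterpart {l} l∈ v∈ v≢x₁ | inj₂ (inj₂ (l≢e₁ , l≢e₂)) = l , old∈B' l∈ l≢e₁ l≢e₂ , sym (S-old l≢e₁ l≢e₂) , v∈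

    lift : ∀ {v} → Boundary h B S v → v ≢ x₁ → Boundary h B' S' v
    lift {v} ((l , l∈ , Sl , v∈l) , other) v≢x₁ =
      let (l' , l'∈ , Sl'≡ , v∈l') = counterpart l∈ v∈l v≢x₁ in (l' , l'∈ , trans Sl'≡ Sl , v∈l') , other′ other
      where
      other′ : v ∈ args h ⊎ (Σ Lit λ k → k ∈ B × S k ≡ false × v ∈ args k) →
               v ∈ args h ⊎ (Σ Lit λ k → k ∈ B' × S' k ≡ false × v ∈ args k)
      other′ (inj₁ v∈h) = inj₁ v∈h
      other′ (inj₂ (k , k∈ , Sk , v∈k)) =
        let (k' , k'∈ , Sk'≡ , v∈k') = counterpart k∈ v∈k v≢x₁ in inj₂ (k' , k'∈ , trans Sk'≡ Sk , v∈k')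

    data X₁Selected : Set where
      in-lit : ∀ {l} → l ∈ B' → S' l ≡ true → x₁ ∈ args l → X₁Selected
      via-f₄ : S' f₄ ≡ true → X₁Selected
      via-f₅ : S' f₅ ≡ true → X₁Selected

    data X₁Unselected : Set where
      in-head : x₁ ∈ args h → X₁Unselected
      in-lit  : ∀ {l} → l ∈ B' → S' l ≡ false → x₁ ∈ args l → X₁Unselected
      via-f₄  : S' f₄ ≡ false → X₁Unselected
      via-f₅  : S' f₅ ≡ false → X₁Unselected

    x₁-selected : ∀ {l} → l ∈ B → S l ≡ true → x₁ ∈ args l → X₁Selected
    x₁-selected {l} l∈ Sl x₁∈ with classify l
    ... | inj₁ refl = via-f₄ (trans (sym S-e₁) Sl)
    ... | inj₂ (inj₁ (_ , refl)) = via-f₅ (trans (sym S-e₂) Sl)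
    ... | inj₂ (inj₂ (l≢e₁ , l≢e₂)) = in-lit (old∈B' l∈ l≢e₁ l≢e₂) (trans (sym (S-old l≢e₁ l≢e₂)) Sl) x₁∈

    x₁-unselected : ∀ {l} → l ∈ B → S l ≡ false → x₁ ∈ args l → X₁Unselected
    x₁-unselected {l} l∈ Sl x₁∈ with classify l
    ... | inj₁ refl = via-f₄ (trans (sym S-e₁) Sl)
    ... | inj₂ (inj₁ (_ , refl)) = via-f₅ (trans (sym S-e₂) Sl)
    ... | inj₂ (inj₂ (l≢e₁ , l≢e₂)) = in-lit (old∈B' l∈ l≢e₁ l≢e₂) (trans (sym (S-old l≢e₁ l≢e₂)) Sl) x₁∈

    Near₁ : ℕ → Set
    Near₁ u = u ≡ x₁ ⊎ u ≡ x₄ ⊎ u ≡ x₅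

    near₁-boundary : X₁Selected → X₁Unselected → Σ ℕ λ u → Near₁ u × Boundary h B' S' u
    near₁-boundary sel unsel with S' f₁ in Sf₁ | S' f₂ in Sf₂
    ... | true  | false = x₁ , inj₁ refl , boundary′ f₁∈B' Sf₁ ∈₁ f₂∈B' Sf₂ ∈₁
    ... | false | true  = x₁ , inj₁ refl , boundary′ f₂∈B' Sf₂ ∈₁ f₁∈B' Sf₁ ∈₁
    ... | true  | true with unsel
    ...   | in-head x₁∈h      = x₁ , inj₁ refl , head-boundary′ f₁∈B' Sf₁ ∈₁ x₁∈h
    ...   | in-lit l∈ Sl x₁∈l = x₁ , inj₁ refl , boundary′ f₁∈B' Sf₁ ∈₁ l∈ Sl x₁∈l
    ...   | via-f₄ Sf₄        = x₄ , inj₂ (inj₁ refl) , boundary′ f₁∈B' Sf₁ ∈₂ f₄∈B' Sf₄ ∈₁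
    ...   | via-f₅ Sf₅        = x₅ , inj₂ (inj₂ refl) , boundary′ f₂∈B' Sf₂ ∈₂ f₅∈B' Sf₅ ∈₁
    near₁-boundary sel unsel | false | false with sel
    ...   | in-lit l∈ Sl x₁∈l = x₁ , inj₁ refl , boundary′ l∈ Sl x₁∈l f₁∈B' Sf₁ ∈₁
    ...   | via-f₄ Sf₄        = x₄ , inj₂ (inj₁ refl) , boundary′ f₄∈B' Sf₄ ∈₁ f₁∈B' Sf₁ ∈₂
    ...   | via-f₅ Sf₅        = x₅ , inj₂ (inj₂ refl) , boundary′ f₅∈B' Sf₅ ∈₁ f₂∈B' Sf₂ ∈₂

    Image : ℕ → ℕ → Set
    Image v u = (v ≢ x₁ × u ≡ v) ⊎ (v ≡ x₁ × Near₁ u)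

    image : ∀ v → Boundary h B S v → Σ ℕ λ u → Image v u × Boundary h B' S' u
    image v bv with v ≟ℕ x₁
    ... | no v≢x₁ = v , inj₁ (v≢x₁ , refl) , lift bv v≢x₁
    image v ((l , l∈ , Sl , x₁∈l) , other) | yes refl with other
    ... | inj₁ x₁∈h =
      let (u , near , bu) = near₁-boundary (x₁-selected l∈ Sl x₁∈l) (in-head x₁∈h)
      in u , inj₂ (refl , near) , bu
    ... | inj₂ (k , k∈ , Sk , x₁∈k) =
      let (u , near , bu) = near₁-boundary (x₁-selected l∈ Sl x₁∈l) (x₁-unselected k∈ Sk x₁∈k)
      in u , inj₂ (refl , near) , bu

    not-near : ∀ {v u} → Boundary h B S v → v ≢ x₁ → Near₁ u → v ≢ u
    not-near _ v≢x₁ (inj₁ refl) = v≢x₁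
    not-near ((l , l∈ , _ , v∈l) , _) _ (inj₂ (inj₁ refl)) = x₄∉old l∈ v∈l
    not-near ((l , l∈ , _ , v∈l) , _) _ (inj₂ (inj₂ refl)) = x₅∉old l∈ v∈l

    image-injective : ∀ {v w u u'} → Boundary h B S v → Boundary h B S w → Image v u → Image w u' → v ≢ w → u ≢ u'
    image-injective _  _  (inj₁ (_ , refl)) (inj₁ (_ , refl)) v≢w = v≢w
    image-injective bv _  (inj₁ (v≢x₁ , refl)) (inj₂ (_ , near)) _ = not-near bv v≢x₁ near
    image-injective _  bw (inj₂ (_ , near)) (inj₁ (w≢x₁ , refl)) _ = ≢-sym (not-near bw w≢x₁ near)
    image-injective _  _  (inj₂ (refl , _)) (inj₂ (refl , _)) v≢w = ⊥-elim (v≢w refl)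

    three : ∀ {A : Set} {x y z} → Boundary h B' S' x → Boundary h B' S' y → Boundary h B' S' z →
      x ≢ y → x ≢ z → y ≢ z → A
    three bx by bz x≢y x≢z y≢z = ⊥-elim (noThree' _ _ _ bx by bz x≢y x≢z y≢z)

    noThree : NoThreeBoundary h B S
    noThree x y z bx by bz x≢y x≢z y≢z with image x bx | image y by | image z bz
    ... | u , ix , bu | u' , iy , bu' | u'' , iz , bu'' =
      three bu bu' bu''
        (image-injective bx by ix iy x≢y) (image-injective bx bz ix iz x≢z) (image-injective by bz iy iz y≢z)

    OldUnselected : Set
    OldUnselected = ∀ {l} → l ∈ B → l ≢ e₁ → l ≢ e₂ → S' l ≡ false

    OldSelectedOnly : Lit → Set
    OldSelectedOnly t = ∀ {l} → l ∈ B → l ≢ e₁ → l ≢ e₂ → S' l ≡ true → l ≡ t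

    old-unselected-only : ∀ {t} → OldUnselected → OldSelectedOnly t
    old-unselected-only unsel l∈ l≢e₁ l≢e₂ Sl = clash Sl (unsel l∈ l≢e₁ l≢e₂)

    at-most-one′ : ∀ t → OldSelectedOnly t
      → (S' f₁ ≡ true → f₁ ≡ t) → (S' f₂ ≡ true → f₂ ≡ t) → (S' f₃ ≡ true → f₃ ≡ t)
      → (S' f₄ ≡ true → f₄ ≡ t) → (S' f₅ ≡ true → f₅ ≡ t) → Trivial B' S'
    at-most-one′ t only-old only₁ only₂ only₃ only₄ only₅ =
      inj₂ λ l l' l∈ l'∈ Sl Sl' → trans (only l∈ Sl) (sym (only l'∈ Sl'))
      where
      only : ∀ {l} → l ∈ B' → S' l ≡ true → l ≡ t
      only l∈ Sl with member l∈
      ... | old l∈B l≢e₁ l≢e₂ = only-old l∈B l≢e₁ l≢e₂ Sl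
      ... | is-f₁ refl = only₁ Sl
      ... | is-f₂ refl = only₂ Sl
      ... | is-f₃ refl = only₃ Sl
      ... | is-f₄ refl = only₄ Sl
      ... | is-f₅ refl = only₅ Sl

    not-selected : ∀ {l t} → S' l ≡ false → S' l ≡ true → l ≡ t
    not-selected Sl≡f Sl≡t = clash Sl≡t Sl≡f

    old-unselected : (∀ {l} → l ∈ B → l ≢ e₁ → l ≢ e₂ → S l ≡ false) → OldUnselected
    old-unselected unsel l∈ l≢e₁ l≢e₂ = trans (sym (S-old l≢e₁ l≢e₂)) (unsel l∈ l≢e₁ l≢e₂)

    only-selected : AtMostOneSelected B S → ∀ {t} → t ∈ B → S t ≡ true → ∀ {l} → l ∈ B → l ≢ t → S l ≡ false
    only-selected amo t∈B St l∈ l≢t = ¬-not λ Sl → l≢t (amo _ _ l∈ t∈B Sl St)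

    x₁-boundary′ : ∀ {l} → OldUnselected → l ∈ B' → S' l ≡ true → x₁ ∈ args l → Boundary h B' S' x₁
    x₁-boundary′ unsel l∈ Sl x₁∈l with x₁-outside
    ... | inj₁ x₁∈h = head-boundary′ l∈ Sl x₁∈l x₁∈h
    ... | inj₂ (o , o∈ , o≢e₁ , o≢e₂ , x₁∈o) = boundary′ l∈ Sl x₁∈l (old∈B' o∈ o≢e₁ o≢e₂) (unsel o∈ o≢e₁ o≢e₂) x₁∈o

    outside-boundary′ : ∀ {v f} → OldUnselected → Outside v → f ∈ B' → S' f ≡ true → v ∈ args f → Boundary h B' S' v
    outside-boundary′ unsel (inj₁ v∈h) f∈ Sf v∈f = head-boundary′ f∈ Sf v∈f v∈h
    outside-boundary′ unsel (inj₂ (o , o∈ , o≢e₁ , o≢e₂ , v∈o)) f∈ Sf v∈f =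
      boundary′ f∈ Sf v∈f (old∈B' o∈ o≢e₁ o≢e₂) (unsel o∈ o≢e₁ o≢e₂) v∈o

    module AllSelectedCase (all : AllSelected B S) where

      Sf₄ : S' f₄ ≡ true
      Sf₄ = trans (sym S-e₁) (all e₁ e₁∈B)
      Sf₅ : S' f₅ ≡ true
      Sf₅ = trans (sym S-e₂) (all e₂ e₂∈B)

      v = proj₁ (dyadic-other h head-dyadic x₁)
      v∈h = proj₁ (proj₂ (dyadic-other h head-dyadic x₁))
      v≢x₁ = proj₂ (proj₂ (dyadic-other h head-dyadic x₁))

      v-boundary : Boundary h B' S' v
      v-boundary = let (l , l∈ , v∈l) = head-vars-in-body v v∈h
                       (l' , l'∈ , Sl'≡ , v∈l') = counterpart l∈ v∈l v≢x₁
                   in head-boundary′ l'∈ (trans Sl'≡ (all l l∈)) v∈l' v∈h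

      trivial′ : Trivial B' S'
      trivial′ with S' f₁ in Sf₁ | S' f₂ in Sf₂ | S' f₃ in Sf₃
      ... | true | true | true = inj₁ all′
        where
        all′ : AllSelected B' S'
        all′ l l∈ with member l∈
        ... | old l∈B l≢e₁ l≢e₂ = trans (sym (S-old l≢e₁ l≢e₂)) (all l l∈B)
        ... | is-f₁ refl = Sf₁
        ... | is-f₂ refl = Sf₂
        ... | is-f₃ refl = Sf₃
        ... | is-f₄ refl = Sf₄
        ... | is-f₅ refl = Sf₅
      ... | _ | _ | false = three (boundary′ f₄∈B' Sf₄ ∈₁ f₃∈B' Sf₃ ∈₁)
                 (boundary′ f₅∈B' Sf₅ ∈₁ f₃∈B' Sf₃ ∈₂) v-boundary
                 x₄≢x₅ (≢-sym (x₄∉head v∈h)) (≢-sym (x₅∉head v∈h))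
      ... | false | false | true = three (boundary′ f₄∈B' Sf₄ ∈₁ f₁∈B' Sf₁ ∈₂)
                 (boundary′ f₅∈B' Sf₅ ∈₁ f₂∈B' Sf₂ ∈₂) v-boundary
                 x₄≢x₅ (≢-sym (x₄∉head v∈h)) (≢-sym (x₅∉head v∈h))
      ... | false | true | true = three (boundary′ f₄∈B' Sf₄ ∈₁ f₁∈B' Sf₁ ∈₂)
                 (boundary′ f₂∈B' Sf₂ ∈₁ f₁∈B' Sf₁ ∈₁) v-boundary
                 (≢-sym x₁≢x₄) (≢-sym (x₄∉head v∈h)) (≢-sym v≢x₁)
      ... | true | false | true = three (boundary′ f₅∈B' Sf₅ ∈₁ f₂∈B' Sf₂ ∈₂)
                 (boundary′ f₁∈B' Sf₁ ∈₁ f₂∈B' Sf₂ ∈₁) v-boundary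
                 (≢-sym x₁≢x₅) (≢-sym (x₅∉head v∈h)) (≢-sym v≢x₁)

    module NoneSelectedCase (unsel : OldUnselected) (Sf₄ : S' f₄ ≡ false) (Sf₅ : S' f₅ ≡ false) where

      trivial′ : Trivial B' S'
      trivial′ with S' f₁ in Sf₁ | S' f₂ in Sf₂ | S' f₃ in Sf₃
      ... | _ | false | false = at-most-one′ f₁ (old-unselected-only unsel) (λ _ → refl) (not-selected Sf₂)
                                  (not-selected Sf₃) (not-selected Sf₄) (not-selected Sf₅)
      ... | false | true | false = at-most-one′ f₂ (old-unselected-only unsel) (not-selected Sf₁) (λ _ → refl)
                                     (not-selected Sf₃) (not-selected Sf₄) (not-selected Sf₅)
      ... | false | false | true = at-most-one′ f₃ (old-unselected-only unsel) (not-selected Sf₁) (not-selected Sf₂)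
                                     (λ _ → refl) (not-selected Sf₄) (not-selected Sf₅)
      ... | true | true | false = three (boundary′ f₁∈B' Sf₁ ∈₂ f₃∈B' Sf₃ ∈₁) (boundary′ f₂∈B' Sf₂ ∈₂ f₃∈B' Sf₃ ∈₂)
                                    (x₁-boundary′ unsel f₁∈B' Sf₁ ∈₁) x₄≢x₅ (≢-sym x₁≢x₄) (≢-sym x₁≢x₅)
      ... | true | false | true = three (boundary′ f₁∈B' Sf₁ ∈₂ f₄∈B' Sf₄ ∈₁) (boundary′ f₃∈B' Sf₃ ∈₂ f₅∈B' Sf₅ ∈₁)
                                    (boundary′ f₁∈B' Sf₁ ∈₁ f₂∈B' Sf₂ ∈₁) x₄≢x₅ (≢-sym x₁≢x₄) (≢-sym x₁≢x₅)
      ... | false | true | true = three (boundary′ f₃∈B' Sf₃ ∈₁ f₄∈B' Sf₄ ∈₁) (boundary′ f₂∈B' Sf₂ ∈₂ f₅∈B' Sf₅ ∈₁)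
                                    (boundary′ f₂∈B' Sf₂ ∈₁ f₁∈B' Sf₁ ∈₁) x₄≢x₅ (≢-sym x₁≢x₄) (≢-sym x₁≢x₅)
      ... | true | true | true = three (boundary′ f₁∈B' Sf₁ ∈₂ f₄∈B' Sf₄ ∈₁) (boundary′ f₂∈B' Sf₂ ∈₂ f₅∈B' Sf₅ ∈₁)
                                   (x₁-boundary′ unsel f₁∈B' Sf₁ ∈₁) x₄≢x₅ (≢-sym x₁≢x₄) (≢-sym x₁≢x₅)

    module E₁SelectedCase (unsel : OldUnselected) (Sf₄ : S' f₄ ≡ true) (Sf₅ : S' f₅ ≡ false) where

      x₂-boundary : Boundary h B' S' x₂
      x₂-boundary = outside-boundary′ unsel x₂-outside f₄∈B' Sf₄ ∈₂

      trivial′ : Trivial B' S'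
      trivial′ with S' f₁ in Sf₁ | S' f₂ in Sf₂ | S' f₃ in Sf₃
      ... | false | false | false = at-most-one′ f₄ (old-unselected-only unsel) (not-selected Sf₁) (not-selected Sf₂)
                                      (not-selected Sf₃) (λ _ → refl) (not-selected Sf₅)
      ... | true | false | false = three (boundary′ f₁∈B' Sf₁ ∈₁ f₂∈B' Sf₂ ∈₁) (boundary′ f₁∈B' Sf₁ ∈₂ f₃∈B' Sf₃ ∈₁)
                                     x₂-boundary x₁≢x₄ x₁≢x₂ (≢-sym x₂≢x₄)
      ... | false | true | false = three (boundary′ f₂∈B' Sf₂ ∈₁ f₁∈B' Sf₁ ∈₁) (boundary′ f₂∈B' Sf₂ ∈₂ f₃∈B' Sf₃ ∈₂)
                                     (boundary′ f₄∈B' Sf₄ ∈₁ f₁∈B' Sf₁ ∈₂) x₁≢x₅ x₁≢x₄ (≢-sym x₄≢x₅)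
      ... | false | false | true = three (boundary′ f₃∈B' Sf₃ ∈₁ f₁∈B' Sf₁ ∈₂) (boundary′ f₃∈B' Sf₃ ∈₂ f₂∈B' Sf₂ ∈₂)
                                     x₂-boundary x₄≢x₅ (≢-sym x₂≢x₄) (≢-sym x₂≢x₅)
      ... | true | true | false = three (x₁-boundary′ unsel f₁∈B' Sf₁ ∈₁) (boundary′ f₂∈B' Sf₂ ∈₂ f₃∈B' Sf₃ ∈₂)
                                    (boundary′ f₁∈B' Sf₁ ∈₂ f₃∈B' Sf₃ ∈₁) x₁≢x₅ x₁≢x₄ (≢-sym x₄≢x₅)
      ... | true | false | true = three (boundary′ f₁∈B' Sf₁ ∈₁ f₂∈B' Sf₂ ∈₁) (boundary′ f₃∈B' Sf₃ ∈₂ f₂∈B' Sf₂ ∈₂)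
                                    x₂-boundary x₁≢x₅ x₁≢x₂ (≢-sym x₂≢x₅)
      ... | false | true | true = three (boundary′ f₂∈B' Sf₂ ∈₁ f₁∈B' Sf₁ ∈₁) (boundary′ f₃∈B' Sf₃ ∈₁ f₁∈B' Sf₁ ∈₂)
                                    x₂-boundary x₁≢x₄ x₁≢x₂ (≢-sym x₂≢x₄)
      ... | true | true | true = three (x₁-boundary′ unsel f₁∈B' Sf₁ ∈₁) (boundary′ f₃∈B' Sf₃ ∈₂ f₅∈B' Sf₅ ∈₁)
                                   x₂-boundary x₁≢x₅ x₁≢x₂ (≢-sym x₂≢x₅)

    module E₂SelectedCase (unsel : OldUnselected) (Sf₅ : S' f₅ ≡ true) (Sf₄ : S' f₄ ≡ false) where

      x₃-boundary : Boundary h B' S' x₃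
      x₃-boundary = outside-boundary′ unsel x₃-outside f₅∈B' Sf₅ ∈₂

      trivial′ : Trivial B' S'
      trivial′ with S' f₁ in Sf₁ | S' f₂ in Sf₂ | S' f₃ in Sf₃
      ... | false | false | false = at-most-one′ f₅ (old-unselected-only unsel) (not-selected Sf₁) (not-selected Sf₂)
                                      (not-selected Sf₃) (not-selected Sf₄) (λ _ → refl)
      ... | false | true | false = three (boundary′ f₂∈B' Sf₂ ∈₁ f₁∈B' Sf₁ ∈₁) (boundary′ f₂∈B' Sf₂ ∈₂ f₃∈B' Sf₃ ∈₂)
                                     x₃-boundary x₁≢x₅ x₁≢x₃ (≢-sym x₃≢x₅)
      ... | true | false | false = three (boundary′ f₁∈B' Sf₁ ∈₁ f₂∈B' Sf₂ ∈₁) (boundary′ f₁∈B' Sf₁ ∈₂ f₃∈B' Sf₃ ∈₁)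
                                     (boundary′ f₅∈B' Sf₅ ∈₁ f₂∈B' Sf₂ ∈₂) x₁≢x₄ x₁≢x₅ x₄≢x₅
      ... | false | false | true = three (boundary′ f₃∈B' Sf₃ ∈₁ f₁∈B' Sf₁ ∈₂) (boundary′ f₃∈B' Sf₃ ∈₂ f₂∈B' Sf₂ ∈₂)
                                     x₃-boundary x₄≢x₅ (≢-sym x₃≢x₄) (≢-sym x₃≢x₅)
      ... | true | true | false = three (x₁-boundary′ unsel f₁∈B' Sf₁ ∈₁) (boundary′ f₁∈B' Sf₁ ∈₂ f₃∈B' Sf₃ ∈₁)
                                    (boundary′ f₂∈B' Sf₂ ∈₂ f₃∈B' Sf₃ ∈₂) x₁≢x₄ x₁≢x₅ x₄≢x₅
      ... | true | false | true = three (boundary′ f₁∈B' Sf₁ ∈₁ f₂∈B' Sf₂ ∈₁) (boundary′ f₁∈B' Sf₁ ∈₂ f₄∈B' Sf₄ ∈₁)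
                                    x₃-boundary x₁≢x₄ x₁≢x₃ (≢-sym x₃≢x₄)
      ... | false | true | true = three (boundary′ f₂∈B' Sf₂ ∈₁ f₁∈B' Sf₁ ∈₁) (boundary′ f₃∈B' Sf₃ ∈₁ f₁∈B' Sf₁ ∈₂)
                                    x₃-boundary x₁≢x₄ x₁≢x₃ (≢-sym x₃≢x₄)
      ... | true | true | true = three (x₁-boundary′ unsel f₁∈B' Sf₁ ∈₁) (boundary′ f₃∈B' Sf₃ ∈₁ f₄∈B' Sf₄ ∈₁)
                                   x₃-boundary x₁≢x₄ x₁≢x₃ (≢-sym x₃≢x₄)

    module OldSelectedCase {t : Lit} (t∈B : t ∈ B) (t≢e₁ : t ≢ e₁) (t≢e₂ : t ≢ e₂) (St : S' t ≡ true)
      (only : OldSelectedOnly t) (Sf₄ : S' f₄ ≡ false) (Sf₅ : S' f₅ ≡ false) where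

      w = proj₁ (dyadic-other t (body-dyadic t t∈B) x₁)
      w∈t = proj₁ (proj₂ (dyadic-other t (body-dyadic t t∈B) x₁))
      w≢x₁ = proj₂ (proj₂ (dyadic-other t (body-dyadic t t∈B) x₁))

      t∈B' : t ∈ B'
      t∈B' = old∈B' t∈B t≢e₁ t≢e₂

      w≢x₄ : w ≢ x₄
      w≢x₄ = x₄∉old t∈B w∈t
      w≢x₅ : w ≢ x₅
      w≢x₅ = x₅∉old t∈B w∈t

      others-unselected : ∀ {l} → l ∈ B → l ≢ t → S l ≡ false
      others-unselected {l} l∈ l≢t with classify l
      ... | inj₁ refl = trans S-e₁ Sf₄
      ... | inj₂ (inj₁ (_ , refl)) = trans S-e₂ Sf₅
      ... | inj₂ (inj₂ (l≢e₁ , l≢e₂)) =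
        trans (S-old l≢e₁ l≢e₂) (¬-not (λ Sl → l≢t (only l∈ l≢e₁ l≢e₂ Sl)))

      w-boundary : Boundary h B' S' w
      w-boundary with body-vars-shared t t∈B w w∈t
      ... | inj₁ w∈h = head-boundary′ t∈B' St w∈t w∈h
      ... | inj₂ (l , l∈ , l≢t , w∈l) =
        let (l' , l'∈ , Sl'≡ , w∈l') = counterpart l∈ w∈l w≢x₁
        in boundary′ t∈B' St w∈t l'∈ (trans Sl'≡ (others-unselected l∈ l≢t)) w∈l'

      trivial′ : Trivial B' S'
      trivial′ with S' f₁ in Sf₁ | S' f₂ in Sf₂ | S' f₃ in Sf₃
      ... | false | false | false = at-most-one′ t only (not-selected Sf₁) (not-selected Sf₂) (not-selected Sf₃)
                                      (not-selected Sf₄) (not-selected Sf₅)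
      ... | true | false | false = three (boundary′ f₁∈B' Sf₁ ∈₁ f₂∈B' Sf₂ ∈₁) (boundary′ f₁∈B' Sf₁ ∈₂ f₃∈B' Sf₃ ∈₁)
                                     w-boundary x₁≢x₄ (≢-sym w≢x₁) (≢-sym w≢x₄)
      ... | false | true | false = three (boundary′ f₂∈B' Sf₂ ∈₁ f₁∈B' Sf₁ ∈₁) (boundary′ f₂∈B' Sf₂ ∈₂ f₃∈B' Sf₃ ∈₂)
                                     w-boundary x₁≢x₅ (≢-sym w≢x₁) (≢-sym w≢x₅)
      ... | false | false | true = three (boundary′ f₃∈B' Sf₃ ∈₁ f₄∈B' Sf₄ ∈₁) (boundary′ f₃∈B' Sf₃ ∈₂ f₅∈B' Sf₅ ∈₁)
                                     w-boundary x₄≢x₅ (≢-sym w≢x₄) (≢-sym w≢x₅)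
      ... | true | true | false = three (boundary′ f₁∈B' Sf₁ ∈₂ f₃∈B' Sf₃ ∈₁) (boundary′ f₂∈B' Sf₂ ∈₂ f₃∈B' Sf₃ ∈₂)
                                    w-boundary x₄≢x₅ (≢-sym w≢x₄) (≢-sym w≢x₅)
      ... | true | _ | true = three (boundary′ f₁∈B' Sf₁ ∈₂ f₄∈B' Sf₄ ∈₁) (boundary′ f₃∈B' Sf₃ ∈₂ f₅∈B' Sf₅ ∈₁)
                                w-boundary x₄≢x₅ (≢-sym w≢x₄) (≢-sym w≢x₅)
      ... | false | true | true = three (boundary′ f₃∈B' Sf₃ ∈₁ f₁∈B' Sf₁ ∈₂) (boundary′ f₂∈B' Sf₂ ∈₂ f₅∈B' Sf₅ ∈₁)
                                    w-boundary x₄≢x₅ (≢-sym w≢x₄) (≢-sym w≢x₅)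

    at-most-one-case : AtMostOneSelected B S → Trivial B' S'
    at-most-one-case amo with any? (λ l → S l ≟B true) B
    ... | no none = NoneSelectedCase.trivial′ (old-unselected λ l∈ _ _ → unselected-S l∈)
                      (trans (sym S-e₁) (unselected-S e₁∈B)) (trans (sym S-e₂) (unselected-S e₂∈B))
      where
      unselected-S : ∀ {l} → l ∈ B → S l ≡ false
      unselected-S l∈ = ¬-not λ Sl → none (lose l∈ Sl)
    ... | yes some with find some
    ...   | t , t∈B , St with classify t
    ...     | inj₁ refl = E₁SelectedCase.trivial′ (old-unselected λ l∈ l≢e₁ _ → others l∈ l≢e₁)
                            (trans (sym S-e₁) St) (trans (sym S-e₂) (others e₂∈B (≢-sym e₁≢e₂)))
      where others = only-selected amo t∈B St
    ...     | inj₂ (inj₁ (_ , refl)) = E₂SelectedCase.trivial′ (old-unselected λ l∈ _ l≢e₂ → others l∈ l≢e₂)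
                                         (trans (sym S-e₂) St) (trans (sym S-e₁) (others e₁∈B e₁≢e₂))
      where others = only-selected amo t∈B St
    ...     | inj₂ (inj₂ (t≢e₁ , t≢e₂)) =
      OldSelectedCase.trivial′ t∈B t≢e₁ t≢e₂ (trans (sym (S-old t≢e₁ t≢e₂)) St)
        (λ l∈ l≢e₁ l≢e₂ Sl → amo _ _ l∈ t∈B (trans (S-old l≢e₁ l≢e₂) Sl) St)
        (trans (sym S-e₁) (others e₁∈B (≢-sym t≢e₁))) (trans (sym S-e₂) (others e₂∈B (≢-sym t≢e₂)))
      where others = only-selected amo t∈B St

    trivial′ : Trivial B' S'
    trivial′ with separating S noThree
    ... | inj₁ all = AllSelectedCase.trivial′ all
    ... | inj₂ amo = at-most-one-case amo

  -- The invariant never compares predicate names.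
  nonRed′ : NonRed h B'
  nonRed′ = record
    { head-dyadic       = head-dyadic
    ; body-dyadic       = body-dyadic′
    ; head-vars-in-body = head-vars-in-body′
    ; body-vars-shared  = body-vars-shared′
    ; three-literals    = three-literals′
    ; separating        = λ S' noThree' → Pullback.trivial′ S' noThree'
    }

nonRedClause-extension : ∀ {C D} → Extension C D → NonRedClause C → NonRedClause D
nonRedClause-extension {just _ ⟵ B}
  (_ , _ , _ , _ , _ , _ , _ , _ , _ , _ , e₁∈B , e₂∈B , e₁≢e₂ , _ , _ , _ , _ , _ , _ ,
   x₄-fresh , x₅-fresh , x₄≢x₅ , head-D , B'≈)
  (h , refl , nonRed) =
  h , head-D , Extend.nonRed′ nonRed e₁∈B e₂∈B e₁≢e₂ x₄-fresh x₅-fresh x₄≢x₅ B'≈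

hnr⇒nonRed : ∀ {C} → Hnr C → NonRedClause C
hnr⇒nonRed (base C≅Cbase)      = nonRedClause-≅⁻ C≅Cbase (base-head , refl , base-nonRed)
hnr⇒nonRed (ext hnr extension) = nonRedClause-extension extension (hnr⇒nonRed hnr)
hnr⇒nonRed (ren hnr C≅D)       = nonRedClause-≅⁺ C≅D (hnr⇒nonRed hnr)

mainTheorem8 : (C : Clause) → Hnr C → Irreducible H2c₂∞ C
mainTheorem8 C hnr = nonRed⇒H2c₂∞ (hnr⇒nonRed hnr) , nonRed⇒¬Reducible (hnr⇒nonRed hnr)
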